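{- Let $n\ge4$ and $d\ge1$ be integers, and let $u_1,\dots,u_n\in(2\mathbb{Z}_{\ge 0})^n$ be points each of whose coordinate sums equals $2d$, such that $\mathcal U=\mathrm{conv}\{u_1,\dots,u_n\}$ is an $(n-1)$-dimensional simplex. Then $(n-2)\mathcal U\cap\mathbb{Z}^n$ is $((n-2)\mathcal U)$-mediated.
   Context: For a simplex $\mathcal V=\mathrm{conv}\{v_1,\dots,v_n\}$ with vertices $v_i\in(2\mathbb{Z})^n$, a set $S\subseteq \mathcal V\cap\mathbb{Z}^n$ containing all vertices $v_i$ is called $\mathcal V$-mediated if every $y\in S$ either equals some vertex $v_i$, or there exist $z_1\neq z_2$ in $S\cap(2\mathbb{Z})^n$ with $y=\tfrac12(z_1+z_2)$. Here $(n-2)\mathcal U$ is the simplex with vertices $(n-2)u_1,\dots,(n-2)u_n$. -}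

module Defs where

open import Data.Nat using (ℕ; zero; suc)
open import Data.Fin using (Fin; zero; suc)
open import Data.Integer as ℤ using (ℤ)
open import Data.Integer.Divisibility using (_∣_)
open import Data.Rational as ℚ using (ℚ; 0ℚ; 1ℚ)
open import Data.Product using (Σ; ∃; _×_)
open import Data.Sum using (_⊎_)
open import Relation.Nullary using (¬_)
open import Relation.Binary.PropositionalEquality using (_≡_)

Point : ℕ → Set
Point n = Fin n → ℤ

sumℤ : (n : ℕ) → (Fin n → ℤ) → ℤ
sumℤ zero    f = ℤ.+ 0
sumℤ (suc n) f = f zero ℤ.+ sumℤ n (λ i → f (suc i))

sumℚ : (n : ℕ) → (Fin n → ℚ) → ℚ
sumℚ zero    f = 0ℚ
sumℚ (suc n) f = f zero ℚ.+ sumℚ n (λ i → f (suc i))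

toℚ : ℤ → ℚ
toℚ z = z ℚ./ 1

_≈ₚ_ : {n : ℕ} → Point n → Point n → Set
x ≈ₚ y = ∀ j → x j ≡ y j

AllEven : {n : ℕ} → Point n → Set
AllEven x = ∀ j → ℤ.+ 2 ∣ x j

InConv : {m n : ℕ} → (Fin m → Point n) → Point n → Set
InConv {m} {n} v y =
  Σ (Fin m → ℚ) λ λ' →
    (∀ i → 0ℚ ℚ.≤ λ' i) ×
    (sumℚ m λ' ≡ 1ℚ) ×
    (∀ j → toℚ (y j) ≡ sumℚ m (λ i → λ' i ℚ.* toℚ (v i j)))

AffinelyIndependent : {m n : ℕ} → (Fin m → Point n) → Set
AffinelyIndependent {m} {n} v =
  (μ : Fin m → ℚ) →
    sumℚ m μ ≡ 0ℚ →
    (∀ j → sumℚ m (λ i → μ i ℚ.* toℚ (v i j)) ≡ 0ℚ) →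
    ∀ i → μ i ≡ 0ℚ

Mediated : {n : ℕ} → (Fin n → Point n) → (Point n → Set) → Set
Mediated {n} v S =
  (∀ i → AllEven (v i)) ×
  (∀ y → S y → InConv v y) ×
  (∀ i → S (v i)) ×
  (∀ y → S y →
     (∃ λ i → y ≈ₚ v i) ⊎
     (Σ (Point n) λ z₁ → Σ (Point n) λ z₂ →
        ¬ (z₁ ≈ₚ z₂) × S z₁ × S z₂ × AllEven z₁ × AllEven z₂ ×
        (∀ j → ℤ.+ 2 ℤ.* y j ≡ z₁ j ℤ.+ z₂ j)))

scaleVerts : {m n : ℕ} → ℕ → (Fin m → Point n) → Fin m → Point n
scaleVerts k v i j = ℤ.+ k ℤ.* v i j

-- Write u_l = 2 V_l, so that V_l ∈ [0,d]^n, and write an integer point y of (n-2)U as y = Σ λ_l V_l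
-- with λ ≥ 0 and Σ λ = 2(n-2). Unless y is a vertex it suffices to find α with 0 ≤ α ≤ λ,
-- Σ α = n-2, Σ α_l V_l integral and 2α ≠ λ: then y is the midpoint of the even points
-- 2 Σ α_l V_l and 2 Σ (λ_l - α_l) V_l of (n-2)U, which differ by affine independence.
-- Split λ = m + f into floors and fractional parts. As Σ f < n, Σ m ≥ n-3. If Σ m ≥ n-2 take
-- α = f + p for an integral 0 ≤ p ≤ m with Σ p = Σ m - (n-2), chosen greedily so that 2α = λ
-- would make y a vertex. If Σ m = n-3, then g = 1 - f satisfies g > 0 and Σ g = 1, and
-- q = Σ g_l V_l = Σ V_l - y + Σ m_l V_l is an integer point in the box. Replacing the vertex
-- V_i that minimises λ_i / g_i by q gives a simplex in which y still has nonnegative weights,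
-- and we recurse (if y becomes 2(n-2) q, then λ = 2(n-2) g and α = (n-3) g + e_i works for
-- any i with m_i ≥ 1). The points q lie in [0,d]^n and are never interior to the later
-- simplices, hence pairwise distinct, so the recursion stops after at most (d+1)^n exchanges.

module Submission where

open import Defs
open import Algebra.Bundles using (CommutativeRing)
import Algebra.Properties.Semiring.Sum
open import Data.Empty using (⊥-elim)
open import Data.Fin as Fin using (Fin; zero; suc)
import Data.Fin.Properties as FinP
open import Data.Integer as ℤ using (ℤ; -[1+_])
open import Data.Integer.Divisibility using (_∣_)
import Data.Integer.Properties as ℤP
open import Data.Nat as ℕ using (ℕ; zero; suc; z≤n; s≤s)
import Data.Nat.Coprimality as Coprime
import Data.Nat.Divisibility as ℕD
open import Data.Nat.DivMod using (_/_; _%_; m≡m%n+[m/n]*n; m%n<n)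
import Data.Nat.Properties as ℕP
open import Data.Product using (Σ; ∃; _×_; _,_; proj₁; proj₂)
open import Data.Sum using (_⊎_; inj₁; inj₂)
open import Algebra.Properties.AbelianGroup ℤP.+-0-abelianGroup using (xyx⁻¹≈y)
open import Data.Vec.Functional using (updateAt)
open import Data.Vec.Functional.Properties using (updateAt-updates; updateAt-minimal)
open import Function using (_∘_; const)
open import Relation.Nullary using (¬_; Dec; yes; no)
open import Relation.Binary.PropositionalEquality

module ℕΣ = Algebra.Properties.Semiring.Sum ℕP.+-*-semiring

-- Used below instead of `with i Fin.≟ l` under hypotheses mentioning toℚ: with-abstraction
-- normalises the types in scope, and normalising toℚ is prohibitively expensive.
cases-at : ∀ {n} {P : Fin n → Set} i → P i → (∀ l → i ≢ l → P l) → ∀ l → P l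
cases-at i Pᵢ Pₗ l with i Fin.≟ l
... | yes refl = Pᵢ
... | no  i≢l  = Pₗ l i≢l

another : ∀ {k} (i : Fin (suc (suc k))) → Σ (Fin (suc (suc k))) λ j → i ≢ j
another zero    = suc zero , λ ()
another (suc i) = zero , λ ()

sum-pos⇒term-pos : ∀ {n} (m : Fin n → ℕ) → 1 ℕ.≤ ℕΣ.sum m → Σ (Fin n) λ l → 1 ℕ.≤ m l
sum-pos⇒term-pos {suc n} m 1≤Σm with m zero in m₀≡
... | suc _ = zero , subst (1 ℕ.≤_) (sym m₀≡) (s≤s z≤n)
... | zero with sum-pos⇒term-pos (m ∘ suc) 1≤Σm
...   | l , 1≤mₗ = suc l , 1≤mₗ

greedy : ∀ {n} → (Fin n → ℕ) → ℕ → Fin n → ℕ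
greedy m t zero    = t ℕ.⊓ m zero
greedy m t (suc l) = greedy (m ∘ suc) (t ℕ.∸ m zero) l

greedy-≤ : ∀ {n} (m : Fin n → ℕ) t l → greedy m t l ℕ.≤ m l
greedy-≤ m t zero    = ℕP.m⊓n≤n t (m zero)
greedy-≤ m t (suc l) = greedy-≤ (m ∘ suc) (t ℕ.∸ m zero) l

greedy-0 : ∀ {n} (m : Fin n → ℕ) l → greedy m 0 l ≡ 0
greedy-0 m zero    = refl
greedy-0 m (suc l) rewrite ℕP.0∸n≡0 (m zero) = greedy-0 (m ∘ suc) l

sum-greedy : ∀ {n} (m : Fin n → ℕ) t → t ℕ.≤ ℕΣ.sum m → ℕΣ.sum (greedy m t) ≡ t
sum-greedy {zero}  m .0 z≤n = refl
sum-greedy {suc n} m t t≤Σm with ℕP.≤-total t (m zero)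
... | inj₁ t≤m₀ rewrite ℕP.m≤n⇒m⊓n≡m t≤m₀ | ℕP.m≤n⇒m∸n≡0 t≤m₀ =
  trans (cong (t ℕ.+_) (trans (ℕΣ.sum-cong-≗ (greedy-0 (m ∘ suc))) (ℕΣ.sum-replicate-zero n))) (ℕP.+-identityʳ t)
... | inj₂ m₀≤t rewrite ℕP.m≥n⇒m⊓n≡n m₀≤t =
  trans (cong (m zero ℕ.+_) (sum-greedy (m ∘ suc) (t ℕ.∸ m zero) (ℕP.m≤n+o⇒m∸n≤o t (m zero) t≤Σm))) (ℕP.m+[n∸m]≡n m₀≤t)

private
  x≡2x⇒x≡0 : ∀ x → x ≡ 2 ℕ.* x → x ≡ 0
  x≡2x⇒x≡0 x x≡2x = sym (trans (ℕP.+-cancelˡ-≡ x 0 (x ℕ.+ 0) (trans (ℕP.+-identityʳ x) x≡2x)) (ℕP.+-identityʳ x))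

greedy-half⇒point-mass : ∀ {n} (m : Fin n → ℕ) t → t ℕ.≤ ℕΣ.sum m → 1 ℕ.≤ t →
  (∀ l → m l ≡ 2 ℕ.* greedy m t l) → Σ (Fin n) λ i → m i ≡ 2 ℕ.* t × (∀ l → i ≢ l → m l ≡ 0)
greedy-half⇒point-mass {zero} m t t≤0 1≤t _ = ⊥-elim (ℕP.<⇒≱ 1≤t t≤0)
greedy-half⇒point-mass {suc n} m t t≤Σm 1≤t m≡2g with ℕP.≤-total t (m zero)
... | inj₁ t≤m₀ = zero , trans (m≡2g zero) (cong (2 ℕ.*_) (ℕP.m≤n⇒m⊓n≡m t≤m₀)) , rest
  where
  rest : ∀ l → zero ≢ l → m l ≡ 0
  rest zero    0≢0 = ⊥-elim (0≢0 refl)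
  rest (suc l) _   = trans (m≡2g (suc l))
    (cong (2 ℕ.*_) (trans (cong (λ s → greedy (m ∘ suc) s l) (ℕP.m≤n⇒m∸n≡0 t≤m₀)) (greedy-0 (m ∘ suc) l)))
... | inj₂ m₀≤t with x≡2x⇒x≡0 (m zero) (trans (m≡2g zero) (cong (2 ℕ.*_) (ℕP.m≥n⇒m⊓n≡n m₀≤t)))
...   | m₀≡0 with greedy-half⇒point-mass (m ∘ suc) t (subst (λ s → t ℕ.≤ s ℕ.+ ℕΣ.sum (m ∘ suc)) m₀≡0 t≤Σm) 1≤t
                   (λ l → subst (λ s → m (suc l) ≡ 2 ℕ.* greedy (m ∘ suc) (t ℕ.∸ s) l) m₀≡0 (m≡2g (suc l)))
...     | i , mᵢ≡2t , rest = suc i , mᵢ≡2t , rest′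
  where
  rest′ : ∀ l → suc i ≢ l → m l ≡ 0
  rest′ zero    _      = m₀≡0
  rest′ (suc l) i′≢l′  = rest l (i′≢l′ ∘ cong suc)

InBox : ∀ {n} → ℕ → Point n → Set
InBox d x = ∀ j → ℤ.+ 0 ℤ.≤ x j × x j ℤ.≤ ℤ.+ d

module _ {n : ℕ} (d : ℕ) where

  private
    digit : ∀ {z} → ℤ.+ 0 ℤ.≤ z × z ℤ.≤ ℤ.+ d → Fin (suc d)
    digit (ℤ.+≤+ _ , ℤ.+≤+ a≤d) = Fin.fromℕ< (s≤s a≤d)

    toℕ-digit : ∀ {z} (z∈ : ℤ.+ 0 ℤ.≤ z × z ℤ.≤ ℤ.+ d) → ℤ.+ Fin.toℕ (digit z∈) ≡ z
    toℕ-digit (ℤ.+≤+ _ , ℤ.+≤+ a≤d) = cong ℤ.+_ (FinP.toℕ-fromℕ< (s≤s a≤d))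

    code : (x : Point n) → InBox d x → Fin (suc d ℕ.^ n)
    code x x∈ = Fin.funToFin (λ j → digit (x∈ j))

    code-injective : ∀ x y x∈ y∈ → code x x∈ ≡ code y y∈ → x ≈ₚ y
    code-injective x y x∈ y∈ eq j = begin
      x j                                                    ≡⟨ toℕ-digit (x∈ j) ⟨
      ℤ.+ Fin.toℕ (digit (x∈ j))                             ≡⟨ cong (ℤ.+_ ∘ Fin.toℕ) (FinP.finToFun-funToFin _ j) ⟨
      ℤ.+ Fin.toℕ (Fin.finToFun (code x x∈) j)               ≡⟨ cong (λ c → ℤ.+ Fin.toℕ (Fin.finToFun c j)) eq ⟩
      ℤ.+ Fin.toℕ (Fin.finToFun (code y y∈) j)               ≡⟨ cong (ℤ.+_ ∘ Fin.toℕ) (FinP.finToFun-funToFin _ j) ⟩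
      ℤ.+ Fin.toℕ (digit (y∈ j))                             ≡⟨ toℕ-digit (y∈ j) ⟩
      y j                                                    ∎
      where open ≡-Reasoning

  box-pigeonhole : ∀ {t} (p : Fin t → Point n) → (∀ a → InBox d (p a)) →
    (∀ a b → a ≢ b → ¬ p a ≈ₚ p b) → t ℕ.≤ suc d ℕ.^ n
  box-pigeonhole {t} p p∈ distinct = ℕP.≮⇒≥ too-many
    where
    too-many : ¬ suc d ℕ.^ n ℕ.< t
    too-many lt with FinP.pigeonhole lt (λ a → code (p a) (p∈ a))
    ... | a , b , a<b , eq = distinct a b (FinP.<⇒≢ a<b) (code-injective (p a) (p b) (p∈ a) (p∈ b) eq)

even-2* : ∀ a → ℤ.+ 2 ∣ ℤ.+ 2 ℤ.* a
even-2* a = subst (2 ℕD.∣_) (sym (ℤP.abs-* (ℤ.+ 2) a)) (ℕD.m∣m*n ℤ.∣ a ∣)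

even-scaleVerts : ∀ {m n} c (u : Fin m → Point n) → (∀ i → AllEven (u i)) → ∀ i → AllEven (scaleVerts c u i)
even-scaleVerts c u u-even i j = subst (2 ℕD.∣_) (sym (ℤP.abs-* (ℤ.+ c) (u i j))) (ℕD.∣n⇒∣m*n c (u-even i j))


module Rationals where
  open import Data.Rational public
    using (ℚ; mkℚ; 0ℚ; 1ℚ; _+_; _*_; _-_; -_; _≤_; _<_; *≤*; *<*; ↥_)
  import Data.Rational as ℚ
  import Data.Rational.Properties as ℚP
  open import Data.Rational.Solver using (module +-*-Solver)
  open import Algebra.Properties.Semiring.Sum (CommutativeRing.semiring ℚP.+-*-commutativeRing)
    using (sum; ∑-distrib-+; *-distribˡ-sum)
  open +-*-Solver
  open import Algebra.Properties.Group ℚP.+-0-group using (x∙y⁻¹≈ε⇒x≈y)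

  toℚ≡mkℚ : ∀ z → toℚ z ≡ mkℚ z 0 (Coprime.sym (Coprime.1-coprimeTo ℤ.∣ z ∣))
  toℚ≡mkℚ z = ℚP.↥p/↧p≡p (mkℚ z 0 _)

  toℚ-homo-+ : ∀ a b → toℚ (a ℤ.+ b) ≡ toℚ a + toℚ b
  toℚ-homo-+ a b rewrite toℚ≡mkℚ a | toℚ≡mkℚ b =
    ℚP./-cong {p₁ = a ℤ.+ b} (cong₂ ℤ._+_ (sym (ℤP.*-identityʳ a)) (sym (ℤP.*-identityʳ b))) refl

  toℚ-homo-* : ∀ a b → toℚ (a ℤ.* b) ≡ toℚ a * toℚ b
  toℚ-homo-* a b rewrite toℚ≡mkℚ a | toℚ≡mkℚ b = refl

  toℚ-double : ∀ a → toℚ (ℤ.+ 2 ℤ.* a) ≡ toℚ a + toℚ a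
  toℚ-double a = trans (toℚ-homo-* (ℤ.+ 2) a) (solve 1 (λ x → (con 1ℚ :+ con 1ℚ) :* x := x :+ x) refl (toℚ a))

  toℚ-homo‿- : ∀ a → toℚ (ℤ.- a) ≡ - toℚ a
  toℚ-homo‿- a = begin
    toℚ (ℤ.- a)                      ≡⟨ solve 2 (λ x y → x := (x :+ y) :- y) refl (toℚ (ℤ.- a)) (toℚ a) ⟩
    (toℚ (ℤ.- a) + toℚ a) - toℚ a    ≡⟨ cong (_- toℚ a) (sym (toℚ-homo-+ (ℤ.- a) a)) ⟩
    toℚ (ℤ.- a ℤ.+ a) - toℚ a        ≡⟨ cong (λ w → toℚ w - toℚ a) (ℤP.+-inverseˡ a) ⟩
    0ℚ - toℚ a                       ≡⟨ ℚP.+-identityˡ _ ⟩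
    - toℚ a                          ∎
    where open ≡-Reasoning

  toℚ-homo-minus : ∀ a b → toℚ (a ℤ.- b) ≡ toℚ a - toℚ b
  toℚ-homo-minus a b = trans (toℚ-homo-+ a (ℤ.- b)) (cong (toℚ a +_) (toℚ-homo‿- b))

  toℚ-injective : ∀ {a b} → toℚ a ≡ toℚ b → a ≡ b
  toℚ-injective {a} {b} eq = cong ↥_ (trans (sym (toℚ≡mkℚ a)) (trans eq (toℚ≡mkℚ b)))

  toℚ-mono-≤ : ∀ {a b} → a ℤ.≤ b → toℚ a ≤ toℚ b
  toℚ-mono-≤ {a} {b} le rewrite toℚ≡mkℚ a | toℚ≡mkℚ b =
    *≤* (subst₂ ℤ._≤_ (sym (ℤP.*-identityʳ a)) (sym (ℤP.*-identityʳ b)) le)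

  toℚ-cancel-≤ : ∀ {a b} → toℚ a ≤ toℚ b → a ℤ.≤ b
  toℚ-cancel-≤ {a} {b} le rewrite toℚ≡mkℚ a | toℚ≡mkℚ b with le
  ... | *≤* p = subst₂ ℤ._≤_ (ℤP.*-identityʳ a) (ℤP.*-identityʳ b) p

  toℚ-mono-< : ∀ {a b} → a ℤ.< b → toℚ a < toℚ b
  toℚ-mono-< {a} {b} le rewrite toℚ≡mkℚ a | toℚ≡mkℚ b =
    *<* (subst₂ ℤ._<_ (sym (ℤP.*-identityʳ a)) (sym (ℤP.*-identityʳ b)) le)

  toℚ-cancel-< : ∀ {a b} → toℚ a < toℚ b → a ℤ.< b
  toℚ-cancel-< {a} {b} le rewrite toℚ≡mkℚ a | toℚ≡mkℚ b with le
  ... | *<* p = subst₂ ℤ._<_ (ℤP.*-identityʳ a) (ℤP.*-identityʳ b) p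

  0≤toℚz<1⇒z≡0 : ∀ z → 0ℚ ≤ toℚ z → toℚ z < 1ℚ → z ≡ ℤ.+ 0
  0≤toℚz<1⇒z≡0 z 0≤z z<1 with toℚ-cancel-≤ {ℤ.+ 0} {z} 0≤z | toℚ-cancel-< {z} {ℤ.+ 1} z<1
  ... | ℤ.+≤+ {n = zero}  _ | _                = refl
  ... | ℤ.+≤+ {n = suc _} _ | ℤ.+<+ (s≤s ())

  0≤toℚ+ : ∀ m → 0ℚ ≤ toℚ (ℤ.+ m)
  0≤toℚ+ m = toℚ-mono-≤ {ℤ.+ 0} {ℤ.+ m} (ℤ.+≤+ z≤n)

  sumℚ≡sum : ∀ n (f : Fin n → ℚ) → sumℚ n f ≡ sum f
  sumℚ≡sum zero    f = refl
  sumℚ≡sum (suc n) f = cong (f zero +_) (sumℚ≡sum n (f ∘ suc))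

  sumℚ-+ : ∀ n (f g : Fin n → ℚ) → sumℚ n (λ i → f i + g i) ≡ sumℚ n f + sumℚ n g
  sumℚ-+ n f g = begin
    sumℚ n (λ i → f i + g i)  ≡⟨ sumℚ≡sum n _ ⟩
    sum (λ i → f i + g i)     ≡⟨ ∑-distrib-+ f g ⟩
    sum f + sum g             ≡⟨ sym (cong₂ _+_ (sumℚ≡sum n f) (sumℚ≡sum n g)) ⟩
    sumℚ n f + sumℚ n g       ∎
    where open ≡-Reasoning

  sumℚ-*ˡ : ∀ n c (f : Fin n → ℚ) → sumℚ n (λ i → c * f i) ≡ c * sumℚ n f
  sumℚ-*ˡ n c f = begin
    sumℚ n (λ i → c * f i)  ≡⟨ sumℚ≡sum n _ ⟩
    sum (λ i → c * f i)     ≡⟨ sym (*-distribˡ-sum c f) ⟩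
    c * sum f               ≡⟨ cong (c *_) (sym (sumℚ≡sum n f)) ⟩
    c * sumℚ n f            ∎
    where open ≡-Reasoning

  sumℚ-cong : ∀ n {f g : Fin n → ℚ} → (∀ i → f i ≡ g i) → sumℚ n f ≡ sumℚ n g
  sumℚ-cong zero    eq = refl
  sumℚ-cong (suc n) eq = cong₂ _+_ (eq zero) (sumℚ-cong n (eq ∘ suc))

  sumℚ-neg : ∀ n (f : Fin n → ℚ) → sumℚ n (λ i → - f i) ≡ - sumℚ n f
  sumℚ-neg zero    f = refl
  sumℚ-neg (suc n) f = trans (cong (- f zero +_) (sumℚ-neg n (f ∘ suc))) (sym (ℚP.neg-distrib-+ (f zero) _))

  sumℚ-minus : ∀ n (f g : Fin n → ℚ) → sumℚ n (λ i → f i - g i) ≡ sumℚ n f - sumℚ n g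
  sumℚ-minus n f g = trans (sumℚ-+ n f (λ i → - g i)) (cong (sumℚ n f +_) (sumℚ-neg n g))

  sumℚ-0 : ∀ n → sumℚ n (λ _ → 0ℚ) ≡ 0ℚ
  sumℚ-0 zero    = refl
  sumℚ-0 (suc n) = trans (ℚP.+-identityˡ _) (sumℚ-0 n)

  sumℚ-1 : ∀ n → sumℚ n (λ _ → 1ℚ) ≡ toℚ (ℤ.+ n)
  sumℚ-1 zero    = refl
  sumℚ-1 (suc n) = trans (cong (1ℚ +_) (sumℚ-1 n)) (sym (toℚ-homo-+ (ℤ.+ 1) (ℤ.+ n)))

  sumℚ-mono-≤ : ∀ n {f g : Fin n → ℚ} → (∀ i → f i ≤ g i) → sumℚ n f ≤ sumℚ n g
  sumℚ-mono-≤ zero    le = ℚP.≤-refl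
  sumℚ-mono-≤ (suc n) le = ℚP.+-mono-≤ (le zero) (sumℚ-mono-≤ n (le ∘ suc))

  sumℚ-nonneg : ∀ n {f : Fin n → ℚ} → (∀ i → 0ℚ ≤ f i) → 0ℚ ≤ sumℚ n f
  sumℚ-nonneg n {f} le = subst (_≤ sumℚ n f) (sumℚ-0 n) (sumℚ-mono-≤ n le)

  term≤sumℚ : ∀ n {f : Fin n → ℚ} → (∀ i → 0ℚ ≤ f i) → ∀ i → f i ≤ sumℚ n f
  term≤sumℚ (suc n) {f} f≥0 zero =
    subst (_≤ sumℚ (suc n) f) (ℚP.+-identityʳ (f zero)) (ℚP.+-monoʳ-≤ (f zero) (sumℚ-nonneg n (f≥0 ∘ suc)))
  term≤sumℚ (suc n) {f} f≥0 (suc i) =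
    subst (_≤ sumℚ (suc n) f) (ℚP.+-identityˡ (f (suc i))) (ℚP.+-mono-≤ (f≥0 zero) (term≤sumℚ n (f≥0 ∘ suc) i))

  two-terms≤sumℚ : ∀ n {f : Fin n → ℚ} → (∀ i → 0ℚ ≤ f i) → ∀ i j → i ≢ j → f i + f j ≤ sumℚ n f
  two-terms≤sumℚ (suc n) f≥0 zero    zero    i≢j = ⊥-elim (i≢j refl)
  two-terms≤sumℚ (suc n) {f} f≥0 zero (suc j) i≢j = ℚP.+-monoʳ-≤ (f zero) (term≤sumℚ n (f≥0 ∘ suc) j)
  two-terms≤sumℚ (suc n) {f} f≥0 (suc i) zero i≢j =
    subst (_≤ sumℚ (suc n) f) (ℚP.+-comm (f zero) (f (suc i))) (ℚP.+-monoʳ-≤ (f zero) (term≤sumℚ n (f≥0 ∘ suc) i))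
  two-terms≤sumℚ (suc n) {f} f≥0 (suc i) (suc j) i≢j = ℚP.≤-trans
    (two-terms≤sumℚ n (f≥0 ∘ suc) i j (i≢j ∘ cong suc))
    (subst (_≤ sumℚ (suc n) f) (ℚP.+-identityˡ _) (ℚP.+-monoˡ-≤ (sumℚ n (f ∘ suc)) (f≥0 zero)))

  sumℚ-<-card : ∀ n {f : Fin (suc n) → ℚ} → (∀ i → f i < 1ℚ) → sumℚ (suc n) f < toℚ (ℤ.+ suc n)
  sumℚ-<-card n {f} f<1 = subst (sumℚ (suc n) f <_) (sumℚ-1 (suc n))
    (ℚP.+-mono-<-≤ (f<1 zero) (sumℚ-mono-≤ n (ℚP.<⇒≤ ∘ f<1 ∘ suc)))

  toℚ-sumℕ : ∀ n (m : Fin n → ℕ) → sumℚ n (λ l → toℚ (ℤ.+ m l)) ≡ toℚ (ℤ.+ ℕΣ.sum m)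
  toℚ-sumℕ zero    m = refl
  toℚ-sumℕ (suc n) m = trans (cong (toℚ (ℤ.+ m zero) +_) (toℚ-sumℕ n (m ∘ suc)))
    (sym (toℚ-homo-+ (ℤ.+ m zero) (ℤ.+ ℕΣ.sum (m ∘ suc))))

  toℚ-sumℤ : ∀ n (f : Fin n → ℤ) → toℚ (sumℤ n f) ≡ sumℚ n (toℚ ∘ f)
  toℚ-sumℤ zero    f = refl
  toℚ-sumℤ (suc n) f = trans (toℚ-homo-+ (f zero) _) (cong (toℚ (f zero) +_) (toℚ-sumℤ n (f ∘ suc)))

  p≤q⇒0≤q-p : ∀ {p q} → p ≤ q → 0ℚ ≤ q - p
  p≤q⇒0≤q-p {p} {q} p≤q = subst (_≤ q - p) (ℚP.+-inverseʳ p) (ℚP.+-monoˡ-≤ (- p) p≤q)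

  0≤q-p⇒p≤q : ∀ {p q} → 0ℚ ≤ q - p → p ≤ q
  0≤q-p⇒p≤q {p} {q} 0≤q-p = subst₂ _≤_ (ℚP.+-identityˡ p) (solve 2 (λ p q → q :- p :+ p := q) refl p q)
    (ℚP.+-monoˡ-≤ p 0≤q-p)

  0≤p+p⇒0≤p : ∀ {p} → 0ℚ ≤ p + p → 0ℚ ≤ p
  0≤p+p⇒0≤p {p} 0≤p+p with 0ℚ ℚP.≤? p
  ... | yes 0≤p = 0≤p
  ... | no  0≰p = ⊥-elim (ℚP.<-irrefl refl (ℚP.<-≤-trans (ℚP.+-mono-< (ℚP.≰⇒> 0≰p) (ℚP.≰⇒> 0≰p)) 0≤p+p))

  p+p≡q+q⇒p≡q : ∀ {p q} → p + p ≡ q + q → p ≡ q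
  p+p≡q+q⇒p≡q {p} {q} p+p≡q+q = begin
    p                 ≡⟨ solve 1 (λ p → p := (p :+ p) :* con ℚ.½) refl p ⟩
    (p + p) * ℚ.½     ≡⟨ cong (_* ℚ.½) p+p≡q+q ⟩
    (q + q) * ℚ.½     ≡⟨ solve 1 (λ q → (q :+ q) :* con ℚ.½ := q) refl q ⟩
    q                 ∎
    where open ≡-Reasoning

  p<q⇒0<q-p : ∀ {p q} → p < q → 0ℚ < q - p
  p<q⇒0<q-p {p} {q} p<q = subst (_< q - p) (ℚP.+-inverseʳ p) (ℚP.+-monoˡ-< (- p) p<q)

  nonNeg*nonNeg : ∀ {p q} → 0ℚ ≤ p → 0ℚ ≤ q → 0ℚ ≤ p * q
  nonNeg*nonNeg {p} {q} 0≤p 0≤q =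
    ℚP.nonNegative⁻¹ (p * q) {{ℚP.nonNeg*nonNeg⇒nonNeg p {{ℚ.nonNegative 0≤p}} q {{ℚ.nonNegative 0≤q}}}}

  nonPos*nonNeg : ∀ {p q} → p ≤ 0ℚ → 0ℚ ≤ q → p * q ≤ 0ℚ
  nonPos*nonNeg {p} {q} p≤0 0≤q = subst (p * q ≤_) (ℚP.*-zeroˡ q) (ℚP.*-monoʳ-≤-nonNeg q {{ℚ.nonNegative 0≤q}} p≤0)

  δ : ∀ {n} → Fin n → Fin n → ℚ
  δ zero    zero    = 1ℚ
  δ zero    (suc _) = 0ℚ
  δ (suc _) zero    = 0ℚ
  δ (suc i) (suc l) = δ i l

  δ-refl : ∀ {n} (i : Fin n) → δ i i ≡ 1ℚ
  δ-refl zero    = refl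
  δ-refl (suc i) = δ-refl i

  δ-≢ : ∀ {n} {i l : Fin n} → i ≢ l → δ i l ≡ 0ℚ
  δ-≢ {i = zero}  {zero}  i≢l = ⊥-elim (i≢l refl)
  δ-≢ {i = zero}  {suc l} i≢l = refl
  δ-≢ {i = suc i} {zero}  i≢l = refl
  δ-≢ {i = suc i} {suc l} i≢l = δ-≢ (i≢l ∘ cong suc)

  δ-nonneg : ∀ {n} (i l : Fin n) → 0ℚ ≤ δ i l
  δ-nonneg zero    zero    = ℚP.<⇒≤ (ℚP.positive⁻¹ 1ℚ)
  δ-nonneg zero    (suc l) = ℚP.≤-refl
  δ-nonneg (suc i) zero    = ℚP.≤-refl
  δ-nonneg (suc i) (suc l) = δ-nonneg i l

  δ-intro : ∀ {n} (f : Fin n → ℚ) c i → f i ≡ c → (∀ l → i ≢ l → f l ≡ 0ℚ) → ∀ l → f l ≡ c * δ i l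
  δ-intro f c i fᵢ≡c rest = cases-at i
    (trans fᵢ≡c (trans (sym (ℚP.*-identityʳ c)) (cong (c *_) (sym (δ-refl i)))))
    (λ l i≢l → trans (rest l i≢l) (trans (sym (ℚP.*-zeroʳ c)) (cong (c *_) (sym (δ-≢ i≢l)))))

  sumℚ-δ* : ∀ n (i : Fin n) (f : Fin n → ℚ) → sumℚ n (λ l → δ i l * f l) ≡ f i
  sumℚ-δ* (suc n) zero f = trans
    (cong₂ _+_ (ℚP.*-identityˡ (f zero)) (trans (sumℚ-cong n (λ l → ℚP.*-zeroˡ (f (suc l)))) (sumℚ-0 n)))
    (ℚP.+-identityʳ _)
  sumℚ-δ* (suc n) (suc i) f = trans (cong₂ _+_ (ℚP.*-zeroˡ (f zero)) (sumℚ-δ* n i (f ∘ suc))) (ℚP.+-identityˡ _)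

  sumℚ-δ : ∀ n (i : Fin n) → sumℚ n (δ i) ≡ 1ℚ
  sumℚ-δ n i = trans (sumℚ-cong n (λ l → sym (ℚP.*-identityʳ (δ i l)))) (sumℚ-δ* n i (λ _ → 1ℚ))

  floorℕ : (q : ℚ) → 0ℚ ≤ q → Σ ℕ λ m → toℚ (ℤ.+ m) ≤ q × q < toℚ (ℤ.+ m) + 1ℚ
  floorℕ (mkℚ -[1+ a ] b _) (*≤* ())
  floorℕ (mkℚ (ℤ.+ a) b-1 c) _ = a / b , m≤q , q<m+1
    where
    b : ℕ
    b = suc b-1
    a≡r+m*b : a ≡ a % b ℕ.+ (a / b) ℕ.* b
    a≡r+m*b = m≡m%n+[m/n]*n a b
    fromℕ≤ : ∀ {m} → m ℕ.* b ℕ.≤ a → toℚ (ℤ.+ m) ≤ mkℚ (ℤ.+ a) b-1 c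
    fromℕ≤ {m} m*b≤a rewrite toℚ≡mkℚ (ℤ.+ m) =
      *≤* (subst₂ ℤ._≤_ (ℤP.pos-* m b) (trans (cong ℤ.+_ (sym (ℕP.*-identityʳ a))) (ℤP.pos-* a 1)) (ℤ.+≤+ m*b≤a))
    fromℕ> : ∀ {m} → a ℕ.< m ℕ.* b → mkℚ (ℤ.+ a) b-1 c < toℚ (ℤ.+ m)
    fromℕ> {m} a<m*b rewrite toℚ≡mkℚ (ℤ.+ m) =
      *<* (subst₂ ℤ._<_ (trans (cong ℤ.+_ (sym (ℕP.*-identityʳ a))) (ℤP.pos-* a 1)) (ℤP.pos-* m b) (ℤ.+<+ a<m*b))
    m≤q : toℚ (ℤ.+ (a / b)) ≤ mkℚ (ℤ.+ a) b-1 c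
    m≤q = fromℕ≤ {a / b} (subst ((a / b) ℕ.* b ℕ.≤_) (sym a≡r+m*b) (ℕP.m≤n+m _ (a % b)))
    q<m+1 : mkℚ (ℤ.+ a) b-1 c < toℚ (ℤ.+ (a / b)) + 1ℚ
    q<m+1 = subst (mkℚ (ℤ.+ a) b-1 c <_) (toℚ-homo-+ (ℤ.+ (a / b)) (ℤ.+ 1)) (fromℕ> {a / b ℕ.+ 1} (begin-strict
      a                          ≡⟨ a≡r+m*b ⟩
      a % b ℕ.+ (a / b) ℕ.* b    <⟨ ℕP.+-monoˡ-< ((a / b) ℕ.* b) (m%n<n a b) ⟩
      b ℕ.+ (a / b) ℕ.* b        ≡⟨ ℕP.+-comm b _ ⟩
      (a / b) ℕ.* b ℕ.+ b        ≡⟨ cong ((a / b) ℕ.* b ℕ.+_) (sym (ℕP.*-identityˡ b)) ⟩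
      (a / b) ℕ.* b ℕ.+ 1 ℕ.* b  ≡⟨ sym (ℕP.*-distribʳ-+ b (a / b) 1) ⟩
      (a / b ℕ.+ 1) ℕ.* b        ∎))
      where open ℕP.≤-Reasoning

  argmin : ∀ {n} (φ : Fin (suc n) → ℚ) → Σ (Fin (suc n)) λ i → ∀ l → φ i ≤ φ l
  argmin {zero}  φ = zero , λ { zero → ℚP.≤-refl }
  argmin {suc n} φ with argmin (φ ∘ suc)
  ... | i , φi≤ with φ zero ℚP.≤? φ (suc i)
  ...   | yes φ0≤φi = zero  , λ { zero → ℚP.≤-refl ; (suc l) → ℚP.≤-trans φ0≤φi (φi≤ l) }
  ...   | no  φ0≰φi = suc i , λ { zero → ℚP.<⇒≤ (ℚP.≰⇒> φ0≰φi) ; (suc l) → φi≤ l }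

  comb : ∀ {m n} → (Fin m → Point n) → (Fin m → ℚ) → Fin n → ℚ
  comb {m} V β j = sumℚ m (λ l → β l * toℚ (V l j))

  IntegralComb : ∀ {m n} → (Fin m → Point n) → (Fin m → ℚ) → Set
  IntegralComb {n = n} V β = Σ (Point n) λ a → ∀ j → toℚ (a j) ≡ comb V β j

  comb-minus : ∀ {m n} (V : Fin m → Point n) β γ j → comb V (λ l → β l - γ l) j ≡ comb V β j - comb V γ j
  comb-minus {m} V β γ j = trans
    (sumℚ-cong m (λ l → solve 3 (λ b c x → (b :- c) :* x := b :* x :- c :* x) refl (β l) (γ l) (toℚ (V l j))))
    (sumℚ-minus m _ _)

  barycentric-unique : ∀ {m n} {V : Fin m → Point n} → AffinelyIndependent V → ∀ β γ →
    sumℚ m β ≡ sumℚ m γ → (∀ j → comb V β j ≡ comb V γ j) → ∀ l → β l ≡ γ l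
  barycentric-unique {m} {V = V} independent β γ Σβ≡Σγ combβ≡combγ l = x∙y⁻¹≈ε⇒x≈y (β l) (γ l)
    (independent (λ l → β l - γ l)
      (trans (sumℚ-minus m β γ) (trans (cong (_- sumℚ m γ) Σβ≡Σγ) (ℚP.+-inverseʳ (sumℚ m γ))))
      (λ j → trans (comb-minus V β γ j) (trans (cong (_- comb V γ j) (combβ≡combγ j)) (ℚP.+-inverseʳ (comb V γ j))))
      l)

  convex-in-box : ∀ {m n d} (V : Fin m → Point n) (c : Fin m → ℚ) (p : Point n) → (∀ l → InBox d (V l)) →
    (∀ l → 0ℚ ≤ c l) → sumℚ m c ≡ 1ℚ → (∀ j → toℚ (p j) ≡ comb V c j) → InBox d p
  convex-in-box {m} {d = d} V c p V∈ c≥0 Σc≡1 p≡ j =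
    toℚ-cancel-≤ (subst (0ℚ ≤_) (sym (p≡ j)) (sumℚ-nonneg m (λ l → nonNeg*nonNeg (c≥0 l) (toℚ-mono-≤ (proj₁ (V∈ l j)))))) ,
    toℚ-cancel-≤ (begin
      toℚ (p j)                     ≡⟨ p≡ j ⟩
      comb V c j                    ≤⟨ sumℚ-mono-≤ m (λ l → ℚP.*-monoˡ-≤-nonNeg (c l) {{ℚ.nonNegative (c≥0 l)}} (toℚ-mono-≤ (proj₂ (V∈ l j)))) ⟩
      sumℚ m (λ l → c l * toℚ (ℤ.+ d)) ≡⟨ sumℚ-cong m (λ l → ℚP.*-comm (c l) _) ⟩
      sumℚ m (λ l → toℚ (ℤ.+ d) * c l) ≡⟨ sumℚ-*ˡ m (toℚ (ℤ.+ d)) c ⟩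
      toℚ (ℤ.+ d) * sumℚ m c        ≡⟨ cong (toℚ (ℤ.+ d) *_) Σc≡1 ⟩
      toℚ (ℤ.+ d) * 1ℚ              ≡⟨ ℚP.*-identityʳ _ ⟩
      toℚ (ℤ.+ d)                   ∎)
    where open ℚP.≤-Reasoning

  vertex-in-conv : ∀ {m n} (v : Fin m → Point n) i → InConv v (v i)
  vertex-in-conv {m} v i = δ i , δ-nonneg i , sumℚ-δ m i , λ j → sym (sumℚ-δ* m i (λ l → toℚ (v l j)))

  NonInterior : ∀ {m n} → (Fin m → Point n) → Point n → Set
  NonInterior {m} V p = Σ (Fin m → ℚ) λ c → sumℚ m c ≡ 1ℚ × (∀ j → toℚ (p j) ≡ comb V c j) × Σ (Fin m) λ l → c l ≤ 0ℚ

  -- Replacing vertex i by q = Σ g_l V_l: weights β over the new vertices are the weights old β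
  -- over the old ones, and new is the inverse of old.
  module Exchange {m : ℕ} (g : Fin m → ℚ) (i : Fin m) .{{g≢0 : ℚ.NonZero (g i)}} where

    g⁻¹ : ℚ
    g⁻¹ = ℚ.1/ g i

    old : (Fin m → ℚ) → Fin m → ℚ
    old β l = β l + β i * (g l - δ i l)

    new : (Fin m → ℚ) → Fin m → ℚ
    new λ' l = λ' l - (λ' i * g⁻¹) * (g l - δ i l)

    sum-old : sumℚ m g ≡ 1ℚ → ∀ β → sumℚ m (old β) ≡ sumℚ m β
    sum-old Σg≡1 β = begin
      sumℚ m (old β)                                     ≡⟨ sumℚ-+ m β _ ⟩
      sumℚ m β + sumℚ m (λ l → β i * (g l - δ i l))      ≡⟨ cong (sumℚ m β +_) (sumℚ-*ˡ m (β i) _) ⟩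
      sumℚ m β + β i * sumℚ m (λ l → g l - δ i l)        ≡⟨ cong (λ s → sumℚ m β + β i * s) (sumℚ-minus m g (δ i)) ⟩
      sumℚ m β + β i * (sumℚ m g - sumℚ m (δ i))         ≡⟨ cong₂ (λ s t → sumℚ m β + β i * (s - t)) Σg≡1 (sumℚ-δ m i) ⟩
      sumℚ m β + β i * (1ℚ - 1ℚ)                         ≡⟨ solve 2 (λ s b → s :+ b :* (con 1ℚ :- con 1ℚ) := s) refl _ (β i) ⟩
      sumℚ m β                                           ∎
      where open ≡-Reasoning

    old-i : ∀ β → old β i ≡ β i * g i
    old-i β = begin
      β i + β i * (g i - δ i i)  ≡⟨ cong (λ e → β i + β i * (g i - e)) (δ-refl i) ⟩
      β i + β i * (g i - 1ℚ)     ≡⟨ solve 2 (λ b c → b :+ b :* (c :- con 1ℚ) := b :* c) refl (β i) (g i) ⟩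
      β i * g i                  ∎
      where open ≡-Reasoning

    new-i : ∀ λ' → new λ' i ≡ λ' i * g⁻¹
    new-i λ' = begin
      λ' i - (λ' i * g⁻¹) * (g i - δ i i)        ≡⟨ cong (λ e → λ' i - (λ' i * g⁻¹) * (g i - e)) (δ-refl i) ⟩
      λ' i - (λ' i * g⁻¹) * (g i - 1ℚ)           ≡⟨ solve 3 (λ a b c → a :- (a :* b) :* (c :- con 1ℚ) := a :- a :* (b :* c) :+ a :* b) refl (λ' i) g⁻¹ (g i) ⟩
      λ' i - λ' i * (g⁻¹ * g i) + λ' i * g⁻¹     ≡⟨ cong (λ e → λ' i - λ' i * e + λ' i * g⁻¹) (ℚP.*-inverseˡ (g i)) ⟩
      λ' i - λ' i * 1ℚ + λ' i * g⁻¹              ≡⟨ solve 2 (λ a b → a :- a :* con 1ℚ :+ a :* b := a :* b) refl (λ' i) g⁻¹ ⟩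
      λ' i * g⁻¹                                 ∎
      where open ≡-Reasoning

    old-new : ∀ λ' l → old (new λ') l ≡ λ' l
    old-new λ' l = begin
      new λ' l + new λ' i * (g l - δ i l)                                  ≡⟨ cong (λ e → new λ' l + e * (g l - δ i l)) (new-i λ') ⟩
      λ' l - (λ' i * g⁻¹) * (g l - δ i l) + (λ' i * g⁻¹) * (g l - δ i l)   ≡⟨ solve 2 (λ a b → a :- b :+ b := a) refl (λ' l) _ ⟩
      λ' l                                                                 ∎
      where open ≡-Reasoning

    old-minus : ∀ β γ l → old (λ l → β l - γ l) l ≡ old β l - old γ l
    old-minus β γ l = solve 5 (λ b c bi ci e → (b :- c) :+ (bi :- ci) :* e := (b :+ bi :* e) :- (c :+ ci :* e))
      refl (β l) (γ l) (β i) (γ i) (g l - δ i l)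

    old-+ : ∀ β γ l → old (λ l → β l + γ l) l ≡ old β l + old γ l
    old-+ β γ l = solve 5 (λ b c bi ci e → (b :+ c) :+ (bi :+ ci) :* e := (b :+ bi :* e) :+ (c :+ ci :* e))
      refl (β l) (γ l) (β i) (γ i) (g l - δ i l)

    old-cong : ∀ {β γ} → (∀ l → β l ≡ γ l) → ∀ l → old β l ≡ old γ l
    old-cong β≡γ l = cong₂ (λ b bi → b + bi * (g l - δ i l)) (β≡γ l) (β≡γ i)

    old-zero : ∀ β → (∀ l → old β l ≡ 0ℚ) → ∀ l → β l ≡ 0ℚ
    old-zero β old≡0 l = begin
      β l                          ≡⟨ solve 2 (λ b e → b := b :+ con 0ℚ :* e) refl (β l) (g l - δ i l) ⟩
      β l + 0ℚ * (g l - δ i l)     ≡⟨ cong (λ b → β l + b * (g l - δ i l)) βi≡0 ⟨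
      old β l                      ≡⟨ old≡0 l ⟩
      0ℚ                           ∎
      where
      open ≡-Reasoning
      βi≡0 : β i ≡ 0ℚ
      βi≡0 = begin
        β i                    ≡⟨ sym (ℚP.*-identityʳ (β i)) ⟩
        β i * 1ℚ               ≡⟨ cong (β i *_) (ℚP.*-inverseʳ (g i)) ⟨
        β i * (g i * g⁻¹)      ≡⟨ ℚP.*-assoc (β i) (g i) g⁻¹ ⟨
        (β i * g i) * g⁻¹      ≡⟨ cong (_* g⁻¹) (trans (sym (old-i β)) (old≡0 i)) ⟩
        0ℚ * g⁻¹               ≡⟨ ℚP.*-zeroˡ g⁻¹ ⟩
        0ℚ                     ∎

    old-injective : ∀ β γ → (∀ l → old β l ≡ old γ l) → ∀ l → β l ≡ γ l
    old-injective β γ old≡ l = x∙y⁻¹≈ε⇒x≈y (β l) (γ l) (old-zero (λ l → β l - γ l) difference≡0 l)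
      where
      difference≡0 : ∀ l → old (λ l → β l - γ l) l ≡ 0ℚ
      difference≡0 l = trans (old-minus β γ l) (trans (cong (_- old γ l) (old≡ l)) (ℚP.+-inverseʳ (old γ l)))

    old-nonneg : (∀ l → 0ℚ ≤ g l) → ∀ β → (∀ l → 0ℚ ≤ β l) → ∀ l → 0ℚ ≤ old β l
    old-nonneg g≥0 β β≥0 l with i Fin.≟ l
    ... | yes refl = subst (0ℚ ≤_) (sym (old-i β)) (nonNeg*nonNeg (β≥0 i) (g≥0 i))
    ... | no  i≢l  = subst (λ e → 0ℚ ≤ β l + β i * (g l - e)) (sym (δ-≢ i≢l))
                      (subst (λ e → 0ℚ ≤ β l + β i * e) (sym (ℚP.+-identityʳ (g l)))
                        (ℚP.+-mono-≤ (β≥0 l) (nonNeg*nonNeg (β≥0 i) (g≥0 l))))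

    updateAt-coord : ∀ {n} (V : Fin m → Point n) (q : Point n) l j →
      toℚ (updateAt V i (const q) l j) ≡ toℚ (V l j) + δ i l * (toℚ (q j) - toℚ (V l j))
    updateAt-coord V q l j with i Fin.≟ l
    ... | yes refl = begin
      toℚ (updateAt V i (const q) i j)                        ≡⟨ cong (λ p → toℚ (p j)) (updateAt-updates i V) ⟩
      toℚ (q j)                                               ≡⟨ solve 2 (λ v q → q := v :+ con 1ℚ :* (q :- v)) refl (toℚ (V i j)) (toℚ (q j)) ⟩
      toℚ (V i j) + 1ℚ * (toℚ (q j) - toℚ (V i j))            ≡⟨ cong (λ e → toℚ (V i j) + e * (toℚ (q j) - toℚ (V i j))) (δ-refl i) ⟨
      toℚ (V i j) + δ i i * (toℚ (q j) - toℚ (V i j))         ∎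
      where open ≡-Reasoning
    ... | no i≢l = begin
      toℚ (updateAt V i (const q) l j)                        ≡⟨ cong (λ p → toℚ (p j)) (updateAt-minimal l i V (i≢l ∘ sym)) ⟩
      toℚ (V l j)                                             ≡⟨ solve 2 (λ v q → v := v :+ con 0ℚ :* (q :- v)) refl (toℚ (V l j)) (toℚ (q j)) ⟩
      toℚ (V l j) + 0ℚ * (toℚ (q j) - toℚ (V l j))            ≡⟨ cong (λ e → toℚ (V l j) + e * (toℚ (q j) - toℚ (V l j))) (δ-≢ i≢l) ⟨
      toℚ (V l j) + δ i l * (toℚ (q j) - toℚ (V l j))         ∎
      where open ≡-Reasoning

    comb-exchange : ∀ {n} (V : Fin m → Point n) (q : Point n) → (∀ j → toℚ (q j) ≡ comb V g j) →
      ∀ β j → comb (updateAt V i (const q)) β j ≡ comb V (old β) j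
    comb-exchange V q q≡ β j = begin
      comb (updateAt V i (const q)) β j
        ≡⟨ sumℚ-cong m (λ l → cong (β l *_) (updateAt-coord V q l j)) ⟩
      sumℚ m (λ l → β l * (X l + δ i l * (Q - X l)))
        ≡⟨ sumℚ-cong m (λ l → solve 4 (λ b x e q → b :* (x :+ e :* (q :- x)) := b :* x :+ e :* (b :* (q :- x))) refl (β l) (X l) (δ i l) Q) ⟩
      sumℚ m (λ l → β l * X l + δ i l * (β l * (Q - X l)))
        ≡⟨ sumℚ-+ m _ _ ⟩
      comb V β j + sumℚ m (λ l → δ i l * (β l * (Q - X l)))
        ≡⟨ cong (comb V β j +_) (sumℚ-δ* m i (λ l → β l * (Q - X l))) ⟩
      comb V β j + β i * (Q - X i)
        ≡⟨ cong (λ s → comb V β j + β i * (s - X i)) (q≡ j) ⟩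
      comb V β j + β i * (comb V g j - X i)
        ≡⟨ cong (λ s → comb V β j + β i * (comb V g j - s)) (sumℚ-δ* m i X) ⟨
      comb V β j + β i * (comb V g j - sumℚ m (λ l → δ i l * X l))
        ≡⟨ cong (λ s → comb V β j + β i * s) (sumℚ-minus m _ _) ⟨
      comb V β j + β i * sumℚ m (λ l → g l * X l - δ i l * X l)
        ≡⟨ cong (comb V β j +_) (sumℚ-*ˡ m (β i) _) ⟨
      comb V β j + sumℚ m (λ l → β i * (g l * X l - δ i l * X l))
        ≡⟨ sumℚ-+ m _ _ ⟨
      sumℚ m (λ l → β l * X l + β i * (g l * X l - δ i l * X l))
        ≡⟨ sumℚ-cong m (λ l → solve 5 (λ b bi c e x → b :* x :+ bi :* (c :* x :- e :* x) := (b :+ bi :* (c :- e)) :* x) refl (β l) (β i) (g l) (δ i l) (X l)) ⟩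
      comb V (old β) j ∎
      where
      open ≡-Reasoning
      X : Fin m → ℚ
      X l = toℚ (V l j)
      Q : ℚ
      Q = toℚ (q j)

    exchange-independent : ∀ {n} (V : Fin m → Point n) (q : Point n) → sumℚ m g ≡ 1ℚ →
      (∀ j → toℚ (q j) ≡ comb V g j) → AffinelyIndependent V → AffinelyIndependent (updateAt V i (const q))
    exchange-independent V q Σg≡1 q≡ independent μ Σμ≡0 combμ≡0 = old-zero μ (independent (old μ)
      (trans (sum-old Σg≡1 μ) Σμ≡0) (λ j → trans (sym (comb-exchange V q q≡ μ j)) (combμ≡0 j)))

    sum-new : sumℚ m g ≡ 1ℚ → ∀ β → sumℚ m (new β) ≡ sumℚ m β
    sum-new Σg≡1 β = trans (sym (sum-old Σg≡1 (new β))) (sumℚ-cong m (old-new β))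

    comb-new : ∀ {n} (V : Fin m → Point n) (q : Point n) → (∀ j → toℚ (q j) ≡ comb V g j) →
      ∀ β j → comb (updateAt V i (const q)) (new β) j ≡ comb V β j
    comb-new V q q≡ β j =
      trans (comb-exchange V q q≡ (new β) j) (sumℚ-cong m (λ l → cong (_* toℚ (V l j)) (old-new β l)))

    old-δ : ∀ c l → old (λ l → c * δ i l) l ≡ c * g l
    old-δ c l = begin
      c * δ i l + (c * δ i i) * (g l - δ i l)  ≡⟨ cong (λ e → c * δ i l + (c * e) * (g l - δ i l)) (δ-refl i) ⟩
      c * δ i l + (c * 1ℚ) * (g l - δ i l)     ≡⟨ solve 3 (λ c e x → c :* e :+ (c :* con 1ℚ) :* (x :- e) := c :* x) refl c (δ i l) (g l) ⟩
      c * g l                                  ∎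
      where open ≡-Reasoning

    new-nonneg : (∀ l → 0ℚ ≤ g l) → 0ℚ ≤ g⁻¹ → ∀ β → 0ℚ ≤ β i → (∀ l → (β i * g⁻¹) * g l ≤ β l) →
      ∀ l → 0ℚ ≤ new β l
    new-nonneg g≥0 g⁻¹≥0 β βᵢ≥0 βᵢg⁻¹g≤β l with i Fin.≟ l
    ... | yes refl = subst (0ℚ ≤_) (sym (new-i β)) (nonNeg*nonNeg βᵢ≥0 g⁻¹≥0)
    ... | no  i≢l  = subst (λ e → 0ℚ ≤ β l - (β i * g⁻¹) * (g l - e)) (sym (δ-≢ i≢l))
                      (subst (λ e → 0ℚ ≤ β l - (β i * g⁻¹) * e) (sym (ℚP.+-identityʳ (g l)))
                        (p≤q⇒0≤q-p (βᵢg⁻¹g≤β l)))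

    new-nonpositive : (∀ l → 0ℚ ≤ g l) → 0ℚ ≤ g⁻¹ → ∀ β → (Σ (Fin m) λ l → β l ≤ 0ℚ) → Σ (Fin m) λ l → new β l ≤ 0ℚ
    new-nonpositive g≥0 g⁻¹≥0 β (l , βₗ≤0) with β i ℚP.≤? 0ℚ
    ... | yes βᵢ≤0 = i , subst (_≤ 0ℚ) (sym (new-i β)) (nonPos*nonNeg βᵢ≤0 g⁻¹≥0)
    ... | no  βᵢ≰0 = l , (begin
      β l - (β i * g⁻¹) * (g l - δ i l)   ≡⟨ cong (λ e → β l - (β i * g⁻¹) * (g l - e)) (δ-≢ i≢l) ⟩
      β l - (β i * g⁻¹) * (g l - 0ℚ)      ≤⟨ ℚP.+-monoʳ-≤ (β l) (ℚP.neg-antimono-≤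
                                               (nonNeg*nonNeg (nonNeg*nonNeg (ℚP.<⇒≤ (ℚP.≰⇒> βᵢ≰0)) g⁻¹≥0)
                                                 (subst (0ℚ ≤_) (sym (ℚP.+-identityʳ (g l))) (g≥0 l)))) ⟩
      β l - 0ℚ                            ≡⟨ ℚP.+-identityʳ (β l) ⟩
      β l                                 ≤⟨ βₗ≤0 ⟩
      0ℚ                                  ∎)
      where
      open ℚP.≤-Reasoning
      i≢l : i ≢ l
      i≢l refl = βᵢ≰0 βₗ≤0

module Splitting (k d : ℕ) (2≤k : 2 ℕ.≤ k) where
  open Rationals
  import Data.Rational as ℚ
  import Data.Rational.Properties as ℚP
  open import Data.Rational.Solver using (module +-*-Solver)
  open +-*-Solver

  n : ℕ
  n = suc (suc k)

  κ : ℚ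
  κ = toℚ (ℤ.+ k)

  IsVertex : (Fin n → ℚ) → Set
  IsVertex w = Σ (Fin n) λ i → ∀ l → w l ≡ (κ + κ) * δ i l

  isVertex? : ∀ w → Dec (IsVertex w)
  isVertex? w = FinP.any? (λ i → FinP.all? (λ l → w l ℚP.≟ (κ + κ) * δ i l))

  record Weights (V : Fin n → Point n) (y : Point n) : Set where
    field
      weight        : Fin n → ℚ
      weight-nonneg : ∀ l → 0ℚ ≤ weight l
      sum-weight    : sumℚ n weight ≡ κ + κ
      weight-comb   : ∀ j → toℚ (y j) ≡ comb V weight j

  record Split (V : Fin n → Point n) (w : Fin n → ℚ) : Set where
    field
      part          : Fin n → ℚ
      part-nonneg   : ∀ l → 0ℚ ≤ part l
      part≤         : ∀ l → part l ≤ w l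
      sum-part      : sumℚ n part ≡ κ
      part-integral : IntegralComb V part
      part-not-half : ¬ (∀ l → part l + part l ≡ w l)

  record BoxSimplex : Set where
    field
      vertex        : Fin n → Point n
      independent   : AffinelyIndependent vertex
      vertex-in-box : ∀ l → InBox d (vertex l)

  record Trail (V : Fin n → Point n) (t : ℕ) : Set where
    field
      point              : Fin t → Point n
      distinct           : ∀ a b → a ≢ b → ¬ point a ≈ₚ point b
      point-in-box       : ∀ a → InBox d (point a)
      point-non-interior : ∀ a → NonInterior V (point a)

  module Floors {V : Fin n → Point n} {y : Point n} (w : Weights V y) (m : Fin n → ℕ)
           (m≤w : ∀ l → toℚ (ℤ.+ m l) ≤ Weights.weight w l)
           (w<m+1 : ∀ l → Weights.weight w l < toℚ (ℤ.+ m l) + 1ℚ) where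
    open Weights w

    frac : Fin n → ℚ
    frac l = weight l - toℚ (ℤ.+ m l)

    frac-nonneg : ∀ l → 0ℚ ≤ frac l
    frac-nonneg l = p≤q⇒0≤q-p (m≤w l)

    frac<1 : ∀ l → frac l < 1ℚ
    frac<1 l = subst (frac l <_) (solve 1 (λ x → (x :+ con 1ℚ) :- x := con 1ℚ) refl (toℚ (ℤ.+ m l)))
      (ℚP.+-monoˡ-< (- toℚ (ℤ.+ m l)) (w<m+1 l))

    sum-frac : sumℚ n frac ≡ (κ + κ) - toℚ (ℤ.+ ℕΣ.sum m)
    sum-frac = trans (sumℚ-minus n weight (λ l → toℚ (ℤ.+ m l))) (cong₂ _-_ sum-weight (toℚ-sumℕ n m))

    floor-sum-large : k ℕ.≤ suc (ℕΣ.sum m)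
    floor-sum-large = ℕP.+-cancelˡ-≤ k k (suc M) (subst (k ℕ.+ k ℕ.≤_) (sym (ℕP.+-suc k M)) (ℕP.≤-pred 2k<n+M))
      where
      M : ℕ
      M = ℕΣ.sum m
      2κ<n+M : toℚ (ℤ.+ (k ℕ.+ k)) < toℚ (ℤ.+ (n ℕ.+ M))
      2κ<n+M = subst₂ _<_
        (trans (solve 2 (λ a b → (a :- b) :+ b := a) refl (κ + κ) (toℚ (ℤ.+ M))) (sym (toℚ-homo-+ (ℤ.+ k) (ℤ.+ k))))
        (sym (toℚ-homo-+ (ℤ.+ n) (ℤ.+ M)))
        (ℚP.+-monoˡ-< (toℚ (ℤ.+ M)) (subst (_< toℚ (ℤ.+ n)) sum-frac (sumℚ-<-card (suc k) frac<1)))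
      2k<n+M : k ℕ.+ k ℕ.< n ℕ.+ M
      2k<n+M = ℤP.drop‿+<+ (toℚ-cancel-< {ℤ.+ (k ℕ.+ k)} {ℤ.+ (n ℕ.+ M)} 2κ<n+M)

    frac+m≡w : ∀ l → frac l + toℚ (ℤ.+ m l) ≡ weight l
    frac+m≡w l = solve 2 (λ a b → a :- b :+ b := a) refl (weight l) (toℚ (ℤ.+ m l))

    module Excess (k≤M : k ℕ.≤ ℕΣ.sum m) where
      M : ℕ
      M = ℕΣ.sum m

      t : ℕ
      t = M ℕ.∸ k

      p : Fin n → ℕ
      p = greedy m t

      sum-p : ℕΣ.sum p ≡ t
      sum-p = sum-greedy m t (ℕP.m∸n≤m M k)

      part : Fin n → ℚ
      part l = frac l + toℚ (ℤ.+ p l)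

      part-nonneg : ∀ l → 0ℚ ≤ part l
      part-nonneg l = subst (_≤ part l) (ℚP.+-identityʳ 0ℚ) (ℚP.+-mono-≤ (frac-nonneg l) (0≤toℚ+ (p l)))

      part≤ : ∀ l → part l ≤ weight l
      part≤ l = subst (part l ≤_) (frac+m≡w l) (ℚP.+-monoʳ-≤ (frac l) (toℚ-mono-≤ (ℤ.+≤+ (greedy-≤ m t l))))

      sum-part : sumℚ n part ≡ κ
      sum-part = begin
        sumℚ n part                                       ≡⟨ sumℚ-+ n frac (λ l → toℚ (ℤ.+ p l)) ⟩
        sumℚ n frac + sumℚ n (λ l → toℚ (ℤ.+ p l))        ≡⟨ cong₂ _+_ sum-frac (trans (toℚ-sumℕ n p) (cong (toℚ ∘ ℤ.+_) sum-p)) ⟩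
        ((κ + κ) - toℚ (ℤ.+ M)) + toℚ (ℤ.+ t)            ≡⟨ cong (λ s → ((κ + κ) - s) + toℚ (ℤ.+ t))
                                                               (trans (cong (toℚ ∘ ℤ.+_) (sym (ℕP.m∸n+n≡m k≤M))) (toℚ-homo-+ (ℤ.+ t) (ℤ.+ k))) ⟩
        ((κ + κ) - (toℚ (ℤ.+ t) + κ)) + toℚ (ℤ.+ t)      ≡⟨ solve 2 (λ K T → ((K :+ K) :- (T :+ K)) :+ T := K) refl κ (toℚ (ℤ.+ t)) ⟩
        κ                                                 ∎
        where open ≡-Reasoning

      part-integral : IntegralComb V part
      part-integral = a , a≡
        where
        a : Point n
        a j = y j ℤ.- sumℤ n (λ l → (ℤ.+ m l ℤ.- ℤ.+ p l) ℤ.* V l j)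
        a≡ : ∀ j → toℚ (a j) ≡ comb V part j
        a≡ j = begin
          toℚ (a j)
            ≡⟨ toℚ-homo-minus (y j) (sumℤ n (λ l → (ℤ.+ m l ℤ.- ℤ.+ p l) ℤ.* V l j)) ⟩
          toℚ (y j) - toℚ (sumℤ n (λ l → (ℤ.+ m l ℤ.- ℤ.+ p l) ℤ.* V l j))
            ≡⟨ cong₂ _-_ (weight-comb j) (trans (toℚ-sumℤ n (λ l → (ℤ.+ m l ℤ.- ℤ.+ p l) ℤ.* V l j)) (sumℚ-cong n λ l →
                 trans (toℚ-homo-* (ℤ.+ m l ℤ.- ℤ.+ p l) (V l j)) (cong (_* toℚ (V l j)) (toℚ-homo-minus (ℤ.+ m l) (ℤ.+ p l))))) ⟩
          comb V weight j - sumℚ n (λ l → (toℚ (ℤ.+ m l) - toℚ (ℤ.+ p l)) * toℚ (V l j))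
            ≡⟨ sumℚ-minus n (λ l → weight l * toℚ (V l j)) (λ l → (toℚ (ℤ.+ m l) - toℚ (ℤ.+ p l)) * toℚ (V l j)) ⟨
          sumℚ n (λ l → weight l * toℚ (V l j) - (toℚ (ℤ.+ m l) - toℚ (ℤ.+ p l)) * toℚ (V l j))
            ≡⟨ sumℚ-cong n (λ l → solve 4 (λ w m p x → w :* x :- (m :- p) :* x := ((w :- m) :+ p) :* x)
                  refl (weight l) (toℚ (ℤ.+ m l)) (toℚ (ℤ.+ p l)) (toℚ (V l j))) ⟩
          comb V part j ∎
          where open ≡-Reasoning

      module _ (half : ∀ l → part l + part l ≡ weight l) where
        frac≡m-2p : ∀ l → frac l ≡ toℚ (ℤ.+ m l ℤ.- ℤ.+ (2 ℕ.* p l))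
        frac≡m-2p l = begin
          frac l
            ≡⟨ solve 3 (λ f m p → f := (m :- (p :+ p)) :+ (((f :+ p) :+ (f :+ p)) :- (f :+ m))) refl (frac l) mℚ pℚ ⟩
          (mℚ - (pℚ + pℚ)) + ((part l + part l) - (frac l + mℚ))
            ≡⟨ cong₂ (λ s t → (mℚ - (pℚ + pℚ)) + (s - t)) (half l) (frac+m≡w l) ⟩
          (mℚ - (pℚ + pℚ)) + (weight l - weight l)
            ≡⟨ solve 2 (λ a w → a :+ (w :- w) := a) refl (mℚ - (pℚ + pℚ)) (weight l) ⟩
          mℚ - (pℚ + pℚ)
            ≡⟨ cong (λ s → mℚ - s) (trans (sym (toℚ-homo-+ (ℤ.+ p l) (ℤ.+ p l))) (cong (toℚ ∘ ℤ.+_ ∘ (p l ℕ.+_)) (sym (ℕP.+-identityʳ (p l))))) ⟩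
          mℚ - toℚ (ℤ.+ (2 ℕ.* p l))
            ≡⟨ toℚ-homo-minus (ℤ.+ m l) (ℤ.+ (2 ℕ.* p l)) ⟨
          toℚ (ℤ.+ m l ℤ.- ℤ.+ (2 ℕ.* p l)) ∎
          where
          open ≡-Reasoning
          mℚ pℚ : ℚ
          mℚ = toℚ (ℤ.+ m l)
          pℚ = toℚ (ℤ.+ p l)

        m-2p≡0 : ∀ l → ℤ.+ m l ℤ.- ℤ.+ (2 ℕ.* p l) ≡ ℤ.+ 0
        m-2p≡0 l = 0≤toℚz<1⇒z≡0 (ℤ.+ m l ℤ.- ℤ.+ (2 ℕ.* p l))
          (subst (0ℚ ≤_) (frac≡m-2p l) (frac-nonneg l)) (subst (_< 1ℚ) (frac≡m-2p l) (frac<1 l))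

        m≡2p : ∀ l → m l ≡ 2 ℕ.* p l
        m≡2p l = ℤP.+-injective (ℤP.i-j≡0⇒i≡j (ℤ.+ m l) (ℤ.+ (2 ℕ.* p l)) (m-2p≡0 l))

        weight≡m : ∀ l → weight l ≡ toℚ (ℤ.+ m l)
        weight≡m l = trans (sym (frac+m≡w l))
          (trans (cong (_+ toℚ (ℤ.+ m l)) (trans (frac≡m-2p l) (cong toℚ (m-2p≡0 l)))) (ℚP.+-identityˡ (toℚ (ℤ.+ m l))))

        t≡k : t ≡ k
        t≡k = ℕP.+-cancelˡ-≡ t t k (sym (begin
          t ℕ.+ k          ≡⟨ ℕP.m∸n+n≡m k≤M ⟩
          M                ≡⟨ ℕΣ.sum-cong-≗ m≡2p ⟩
          ℕΣ.sum (λ l → 2 ℕ.* p l) ≡⟨ ℕΣ.*-distribˡ-sum 2 p ⟨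
          2 ℕ.* ℕΣ.sum p   ≡⟨ cong (2 ℕ.*_) sum-p ⟩
          2 ℕ.* t          ≡⟨ cong (t ℕ.+_) (ℕP.+-identityʳ t) ⟩
          t ℕ.+ t          ∎))
          where open ≡-Reasoning

        half⇒vertex : IsVertex weight
        half⇒vertex = vertex-at (greedy-half⇒point-mass m t (ℕP.m∸n≤m M k) (subst (1 ℕ.≤_) (sym t≡k) (ℕP.≤-trans (s≤s z≤n) 2≤k)) m≡2p)
          where
          vertex-at : (Σ (Fin n) λ i → m i ≡ 2 ℕ.* t × (∀ l → i ≢ l → m l ≡ 0)) → IsVertex weight
          vertex-at (i , mᵢ≡2t , mₗ≡0) = i , δ-intro weight (κ + κ) i wᵢ≡2κ (λ l i≢l → trans (weight≡m l) (cong (toℚ ∘ ℤ.+_) (mₗ≡0 l i≢l)))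
            where
            wᵢ≡2κ : weight i ≡ κ + κ
            wᵢ≡2κ = begin
              weight i                    ≡⟨ weight≡m i ⟩
              toℚ (ℤ.+ m i)               ≡⟨ cong (toℚ ∘ ℤ.+_) (trans mᵢ≡2t (cong (λ s → s ℕ.+ (s ℕ.+ 0)) t≡k)) ⟩
              toℚ (ℤ.+ (k ℕ.+ (k ℕ.+ 0))) ≡⟨ cong (toℚ ∘ ℤ.+_ ∘ (k ℕ.+_)) (ℕP.+-identityʳ k) ⟩
              toℚ (ℤ.+ (k ℕ.+ k))         ≡⟨ toℚ-homo-+ (ℤ.+ k) (ℤ.+ k) ⟩
              κ + κ                       ∎
              where open ≡-Reasoning

      split : ¬ IsVertex weight → Split V weight
      split ¬vertex = record
        { part          = part
        ; part-nonneg   = part-nonneg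
        ; part≤         = part≤
        ; sum-part      = sum-part
        ; part-integral = part-integral
        ; part-not-half = ¬vertex ∘ half⇒vertex
        }

    module Deficient (M+1≡k : suc (ℕΣ.sum m) ≡ k) where
      M : ℕ
      M = ℕΣ.sum m

      Mℚ : ℚ
      Mℚ = toℚ (ℤ.+ M)

      κ≡1+M : κ ≡ 1ℚ + Mℚ
      κ≡1+M = trans (cong (toℚ ∘ ℤ.+_) (sym M+1≡k)) (toℚ-homo-+ (ℤ.+ 1) (ℤ.+ M))

      g : Fin n → ℚ
      g l = 1ℚ - frac l

      g-pos : ∀ l → 0ℚ < g l
      g-pos l = p<q⇒0<q-p (frac<1 l)

      g-nonneg : ∀ l → 0ℚ ≤ g l
      g-nonneg l = ℚP.<⇒≤ (g-pos l)

      sum-g : sumℚ n g ≡ 1ℚ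
      sum-g = begin
        sumℚ n g                                   ≡⟨ sumℚ-minus n (λ _ → 1ℚ) frac ⟩
        sumℚ n (λ _ → 1ℚ) - sumℚ n frac            ≡⟨ cong₂ _-_ (trans (sumℚ-1 n) (toℚ-homo-+ (ℤ.+ 2) (ℤ.+ k))) sum-frac ⟩
        (toℚ (ℤ.+ 2) + κ) - ((κ + κ) - Mℚ)         ≡⟨ cong (λ K → (toℚ (ℤ.+ 2) + K) - ((K + K) - Mℚ)) κ≡1+M ⟩
        (toℚ (ℤ.+ 2) + (1ℚ + Mℚ)) - (((1ℚ + Mℚ) + (1ℚ + Mℚ)) - Mℚ)
          ≡⟨ solve 1 (λ M → ((con 1ℚ :+ con 1ℚ) :+ (con 1ℚ :+ M)) :- (((con 1ℚ :+ M) :+ (con 1ℚ :+ M)) :- M) := con 1ℚ) refl Mℚ ⟩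
        1ℚ                                         ∎
        where open ≡-Reasoning

      g<1 : ∀ l → g l < 1ℚ
      g<1 l = ℚP.<-≤-trans (subst (_< g l + g o) (ℚP.+-identityʳ (g l)) (ℚP.+-monoʳ-< (g l) (g-pos o)))
        (subst (g l + g o ≤_) sum-g (two-terms≤sumℚ n g-nonneg l o l≢o))
        where
        o : Fin n
        o = proj₁ (another l)
        l≢o : l ≢ o
        l≢o = proj₂ (another l)

      weight≡m+1-g : ∀ l → weight l ≡ toℚ (ℤ.+ m l) + (1ℚ - g l)
      weight≡m+1-g l = solve 2 (λ w m → w := m :+ (con 1ℚ :- (con 1ℚ :- (w :- m)))) refl (weight l) (toℚ (ℤ.+ m l))

      weight-pos : ∀ l → 0ℚ < weight l
      weight-pos l = subst (0ℚ <_) (sym (weight≡m+1-g l))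
        (subst (_< toℚ (ℤ.+ m l) + (1ℚ - g l)) (ℚP.+-identityˡ 0ℚ) (ℚP.+-mono-≤-< (0≤toℚ+ (m l)) (p<q⇒0<q-p (g<1 l))))

      q : Point n
      q j = sumℤ n (λ l → V l j) ℤ.- y j ℤ.+ sumℤ n (λ l → ℤ.+ m l ℤ.* V l j)

      q≡comb : ∀ j → toℚ (q j) ≡ comb V g j
      q≡comb j = begin
        toℚ (q j)
          ≡⟨ toℚ-homo-+ (sumℤ n (λ l → V l j) ℤ.- y j) (sumℤ n (λ l → ℤ.+ m l ℤ.* V l j)) ⟩
        toℚ (sumℤ n (λ l → V l j) ℤ.- y j) + toℚ (sumℤ n (λ l → ℤ.+ m l ℤ.* V l j))
          ≡⟨ cong₂ _+_ (trans (toℚ-homo-minus (sumℤ n (λ l → V l j)) (y j)) (cong₂ _-_ (toℚ-sumℤ n (λ l → V l j)) (weight-comb j)))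
                       (trans (toℚ-sumℤ n (λ l → ℤ.+ m l ℤ.* V l j)) (sumℚ-cong n (λ l → toℚ-homo-* (ℤ.+ m l) (V l j)))) ⟩
        (sumℚ n X - comb V weight j) + sumℚ n (λ l → toℚ (ℤ.+ m l) * X l)
          ≡⟨ cong (_+ sumℚ n (λ l → toℚ (ℤ.+ m l) * X l)) (sumℚ-minus n X (λ l → weight l * X l)) ⟨
        sumℚ n (λ l → X l - weight l * X l) + sumℚ n (λ l → toℚ (ℤ.+ m l) * X l)
          ≡⟨ sumℚ-+ n (λ l → X l - weight l * X l) (λ l → toℚ (ℤ.+ m l) * X l) ⟨
        sumℚ n (λ l → (X l - weight l * X l) + toℚ (ℤ.+ m l) * X l)
          ≡⟨ sumℚ-cong n (λ l → solve 3 (λ x w m → (x :- w :* x) :+ m :* x := (con 1ℚ :- (w :- m)) :* x) refl (X l) (weight l) (toℚ (ℤ.+ m l))) ⟩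
        comb V g j ∎
        where
        open ≡-Reasoning
        X : Fin n → ℚ
        X l = toℚ (V l j)

      positive-floor : Σ (Fin n) λ i → 1 ℕ.≤ m i
      positive-floor = sum-pos⇒term-pos m (ℕP.≤-pred (subst (2 ℕ.≤_) (sym M+1≡k) 2≤k))

      2κ≡[1+M]+[1+M] : κ + κ ≡ (1ℚ + Mℚ) + (1ℚ + Mℚ)
      2κ≡[1+M]+[1+M] = cong (λ K → K + K) κ≡1+M

      module Proportional (i : Fin n) (1≤mᵢ : 1 ℕ.≤ m i) (w≡2κg : ∀ l → weight l ≡ (κ + κ) * g l) where
        part : Fin n → ℚ
        part l = Mℚ * g l + δ i l

        part-nonneg : ∀ l → 0ℚ ≤ part l
        part-nonneg l = subst (_≤ part l) (ℚP.+-identityʳ 0ℚ) (ℚP.+-mono-≤ (nonNeg*nonNeg (0≤toℚ+ M) (g-nonneg l)) (δ-nonneg i l))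

        sum-part : sumℚ n part ≡ κ
        sum-part = begin
          sumℚ n part                              ≡⟨ sumℚ-+ n (λ l → Mℚ * g l) (δ i) ⟩
          sumℚ n (λ l → Mℚ * g l) + sumℚ n (δ i)   ≡⟨ cong₂ _+_ (trans (sumℚ-*ˡ n Mℚ g) (cong (Mℚ *_) sum-g)) (sumℚ-δ n i) ⟩
          Mℚ * 1ℚ + 1ℚ                             ≡⟨ solve 1 (λ M → M :* con 1ℚ :+ con 1ℚ := con 1ℚ :+ M) refl Mℚ ⟩
          1ℚ + Mℚ                                  ≡⟨ κ≡1+M ⟨
          κ                                        ∎
          where open ≡-Reasoning

        part-integral : IntegralComb V part
        part-integral = a , a≡
          where
          a : Point n
          a j = ℤ.+ M ℤ.* q j ℤ.+ V i j
          a≡ : ∀ j → toℚ (a j) ≡ comb V part j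
          a≡ j = begin
            toℚ (a j)                                  ≡⟨ toℚ-homo-+ (ℤ.+ M ℤ.* q j) (V i j) ⟩
            toℚ (ℤ.+ M ℤ.* q j) + X i                  ≡⟨ cong (_+ X i) (trans (toℚ-homo-* (ℤ.+ M) (q j)) (cong (Mℚ *_) (q≡comb j))) ⟩
            Mℚ * comb V g j + X i                      ≡⟨ cong₂ _+_ (sumℚ-*ˡ n Mℚ (λ l → g l * X l)) (sumℚ-δ* n i X) ⟨
            sumℚ n (λ l → Mℚ * (g l * X l)) + sumℚ n (λ l → δ i l * X l)
                                                       ≡⟨ sumℚ-+ n (λ l → Mℚ * (g l * X l)) (λ l → δ i l * X l) ⟨
            sumℚ n (λ l → Mℚ * (g l * X l) + δ i l * X l)
                                                       ≡⟨ sumℚ-cong n (λ l → solve 4 (λ M G e x → M :* (G :* x) :+ e :* x := (M :* G :+ e) :* x)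
                                                            refl Mℚ (g l) (δ i l) (X l)) ⟩
            comb V part j                              ∎
            where
            open ≡-Reasoning
            X : Fin n → ℚ
            X l = toℚ (V l j)

        twice-gap-at-i : (weight i - part i) + (weight i - part i) ≡ (toℚ (ℤ.+ m i) - 1ℚ) + g i
        twice-gap-at-i = begin
          (weight i - part i) + (weight i - part i)
            ≡⟨ cong (λ e → (weight i - (Mℚ * G + e)) + (weight i - (Mℚ * G + e))) (δ-refl i) ⟩
          (weight i - (Mℚ * G + 1ℚ)) + (weight i - (Mℚ * G + 1ℚ))
            ≡⟨ solve 4 (λ W G M m → (W :- (M :* G :+ con 1ℚ)) :+ (W :- (M :* G :+ con 1ℚ))
                                 := ((m :- con 1ℚ) :+ G) :+ (W :- ((con 1ℚ :+ M) :+ (con 1ℚ :+ M)) :* G) :+ (W :- (m :+ (con 1ℚ :- G))))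
                 refl (weight i) G Mℚ mℚ ⟩
          ((mℚ - 1ℚ) + G) + (weight i - ((1ℚ + Mℚ) + (1ℚ + Mℚ)) * G) + (weight i - (mℚ + (1ℚ - G)))
            ≡⟨ cong₂ (λ s t → ((mℚ - 1ℚ) + G) + (weight i - s) + (weight i - t))
                 (trans (cong (_* G) (sym 2κ≡[1+M]+[1+M])) (sym (w≡2κg i))) (sym (weight≡m+1-g i)) ⟩
          ((mℚ - 1ℚ) + G) + (weight i - weight i) + (weight i - weight i)
            ≡⟨ solve 2 (λ a W → a :+ (W :- W) :+ (W :- W) := a) refl ((mℚ - 1ℚ) + G) (weight i) ⟩
          (mℚ - 1ℚ) + G ∎
          where
          open ≡-Reasoning
          G mℚ : ℚ
          G = g i
          mℚ = toℚ (ℤ.+ m i)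

        gap-elsewhere : ∀ l → i ≢ l → weight l - part l ≡ (toℚ (ℤ.+ 2) + Mℚ) * g l
        gap-elsewhere l i≢l = begin
          weight l - (Mℚ * g l + δ i l)
            ≡⟨ cong₂ (λ s e → s - (Mℚ * g l + e)) (trans (w≡2κg l) (cong (_* g l) 2κ≡[1+M]+[1+M])) (δ-≢ i≢l) ⟩
          ((1ℚ + Mℚ) + (1ℚ + Mℚ)) * g l - (Mℚ * g l + 0ℚ)
            ≡⟨ solve 2 (λ M G → ((con 1ℚ :+ M) :+ (con 1ℚ :+ M)) :* G :- (M :* G :+ con 0ℚ) := ((con 1ℚ :+ con 1ℚ) :+ M) :* G)
                 refl Mℚ (g l) ⟩
          (toℚ (ℤ.+ 2) + Mℚ) * g l ∎
          where open ≡-Reasoning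

        part≤ : ∀ l → part l ≤ weight l
        part≤ = cases-at i
          (0≤q-p⇒p≤q (0≤p+p⇒0≤p (subst (0ℚ ≤_) (sym twice-gap-at-i)
            (ℚP.+-mono-≤ (p≤q⇒0≤q-p (toℚ-mono-≤ (ℤ.+≤+ 1≤mᵢ))) (g-nonneg i)))))
          (λ l i≢l → 0≤q-p⇒p≤q (subst (0ℚ ≤_) (sym (gap-elsewhere l i≢l))
            (nonNeg*nonNeg (subst (_≤ toℚ (ℤ.+ 2) + Mℚ) (ℚP.+-identityˡ 0ℚ) (ℚP.+-mono-≤ (0≤toℚ+ 2) (0≤toℚ+ M))) (g-nonneg l))))

        half⇒1≤gᵢ : (∀ l → part l + part l ≡ weight l) → 1ℚ ≤ g i
        half⇒1≤gᵢ half = 0≤q-p⇒p≤q (0≤p+p⇒0≤p (ℚP.≤-reflexive (sym (begin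
          (G - 1ℚ) + (G - 1ℚ)
            ≡⟨ solve 3 (λ G M W → (G :- con 1ℚ) :+ (G :- con 1ℚ)
                              := (((con 1ℚ :+ M) :+ (con 1ℚ :+ M)) :* G :- W) :+ (W :- ((M :* G :+ con 1ℚ) :+ (M :* G :+ con 1ℚ)))) refl G Mℚ (weight i) ⟩
          (((1ℚ + Mℚ) + (1ℚ + Mℚ)) * G - weight i) + (weight i - ((Mℚ * G + 1ℚ) + (Mℚ * G + 1ℚ)))
            ≡⟨ cong₂ (λ s e → (s - weight i) + (weight i - ((Mℚ * G + e) + (Mℚ * G + e))))
                 (trans (cong (_* G) (sym 2κ≡[1+M]+[1+M])) (sym (w≡2κg i))) (sym (δ-refl i)) ⟩
          (weight i - weight i) + (weight i - (part i + part i))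
            ≡⟨ cong (λ s → (weight i - weight i) + (weight i - s)) (half i) ⟩
          (weight i - weight i) + (weight i - weight i)
            ≡⟨ solve 1 (λ W → (W :- W) :+ (W :- W) := con 0ℚ) refl (weight i) ⟩
          0ℚ ∎))))
          where
          open ≡-Reasoning
          G : ℚ
          G = g i

        split : Split V weight
        split = record
          { part          = part
          ; part-nonneg   = part-nonneg
          ; part≤         = part≤
          ; sum-part      = sum-part
          ; part-integral = part-integral
          ; part-not-half = λ half → ℚP.<-irrefl refl (ℚP.<-≤-trans (g<1 i) (half⇒1≤gᵢ half))
          }

  SplitsAt : ℕ → Set
  SplitsAt t = (S : BoxSimplex) → Trail (BoxSimplex.vertex S) t →
    ∀ {y} (w : Weights (BoxSimplex.vertex S) y) → ¬ IsVertex (Weights.weight w) → Split (BoxSimplex.vertex S) (Weights.weight w)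

  module Exchanging (S : BoxSimplex) {t : ℕ} (T : Trail (BoxSimplex.vertex S) t) {y : Point n} (w : Weights (BoxSimplex.vertex S) y)
    (m : Fin n → ℕ) (m≤w : ∀ l → toℚ (ℤ.+ m l) ≤ Weights.weight w l)
    (w<m+1 : ∀ l → Weights.weight w l < toℚ (ℤ.+ m l) + 1ℚ) (M+1≡k : suc (ℕΣ.sum m) ≡ k) where
    open BoxSimplex S
    open Weights w
    open Floors w m m≤w w<m+1
    open Deficient M+1≡k

    instance
      g≢0 : ∀ {l} → ℚ.NonZero (g l)
      g≢0 {l} = ℚP.pos⇒nonZero (g l) {{ℚ.positive (g-pos l)}}

    1/g-nonneg : ∀ l → 0ℚ ≤ ℚ.1/ g l
    1/g-nonneg l = ℚP.<⇒≤ (ℚP.positive⁻¹ (ℚ.1/ g l) {{ℚP.1/pos⇒pos (g l) {{ℚ.positive (g-pos l)}}}})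

    module Pivot (i : Fin n) (i-minimal : ∀ l → weight i * ℚ.1/ g i ≤ weight l * ℚ.1/ g l) where
      open Exchange g i


      vertex′ : Fin n → Point n
      vertex′ = updateAt vertex i (const q)

      simplex′ : BoxSimplex
      simplex′ = record
        { vertex        = vertex′
        ; independent   = exchange-independent vertex q sum-g q≡comb independent
        ; vertex-in-box = in-box
        }
        where
        in-box : ∀ l → InBox d (vertex′ l)
        in-box = cases-at i
          (subst (InBox d) (sym (updateAt-updates i {f = const q} vertex)) (convex-in-box vertex g q vertex-in-box g-nonneg sum-g q≡comb))
          (λ l i≢l → subst (InBox d) (sym (updateAt-minimal l i {f = const q} vertex (i≢l ∘ sym))) (vertex-in-box l))

      weights′ : Weights vertex′ y
      weights′ = record
        { weight        = new weight
        ; weight-nonneg = new-nonneg g-nonneg (1/g-nonneg i) weight (weight-nonneg i) ratio-bound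
        ; sum-weight    = trans (sum-new sum-g weight) sum-weight
        ; weight-comb   = λ j → trans (weight-comb j) (sym (comb-new vertex q q≡comb weight j))
        }
        where
        ratio-bound : ∀ l → (weight i * g⁻¹) * g l ≤ weight l
        ratio-bound l = begin
          (weight i * g⁻¹) * g l              ≤⟨ ℚP.*-monoʳ-≤-nonNeg (g l) {{ℚ.nonNegative (g-nonneg l)}} (i-minimal l) ⟩
          (weight l * ℚ.1/ g l) * g l         ≡⟨ ℚP.*-assoc (weight l) (ℚ.1/ g l) (g l) ⟩
          weight l * (ℚ.1/ g l * g l)         ≡⟨ cong (weight l *_) (ℚP.*-inverseˡ (g l)) ⟩
          weight l * 1ℚ                       ≡⟨ ℚP.*-identityʳ (weight l) ⟩
          weight l                            ∎
          where open ℚP.≤-Reasoning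

      q∉trail : ∀ b → ¬ q ≈ₚ Trail.point T b
      q∉trail b q≈p = absurd (Trail.point-non-interior T b)
        where
        absurd : ¬ NonInterior vertex (Trail.point T b)
        absurd (c , Σc≡1 , p≡c , l , cₗ≤0) = ℚP.<-irrefl refl (ℚP.<-≤-trans (g-pos l) (subst (_≤ 0ℚ) (sym (g≡c l)) cₗ≤0))
          where
          g≡c : ∀ l → g l ≡ c l
          g≡c = barycentric-unique {V = vertex} independent g c (trans sum-g (sym Σc≡1))
                  (λ j → trans (sym (q≡comb j)) (trans (cong toℚ (q≈p j)) (p≡c j)))

      trail′ : Trail vertex′ (suc t)
      trail′ = record
        { point              = point′
        ; distinct           = distinct′
        ; point-in-box       = in-box′
        ; point-non-interior = non-interior′
        }
        where
        open Trail T
        point′ : Fin (suc t) → Point n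
        point′ zero    = q
        point′ (suc a) = point a
        distinct′ : ∀ a b → a ≢ b → ¬ point′ a ≈ₚ point′ b
        distinct′ zero    zero    0≢0 = ⊥-elim (0≢0 refl)
        distinct′ zero    (suc b) _   = q∉trail b
        distinct′ (suc a) zero    _   = λ p≈q → q∉trail a (sym ∘ p≈q)
        distinct′ (suc a) (suc b) a≢b = distinct a b (a≢b ∘ cong suc)
        in-box′ : ∀ a → InBox d (point′ a)
        in-box′ zero    = convex-in-box vertex g q vertex-in-box g-nonneg sum-g q≡comb
        in-box′ (suc a) = point-in-box a
        non-interior′ : ∀ a → NonInterior vertex′ (point′ a)
        non-interior′ zero = δ i , sumℚ-δ n i ,
          (λ j → sym (trans (sumℚ-δ* n i (λ l → toℚ (vertex′ l j))) (cong (λ p → toℚ (p j)) (updateAt-updates i {f = const q} vertex)))) ,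
          proj₁ (another i) , ℚP.≤-reflexive (δ-≢ (proj₂ (another i)))
        non-interior′ (suc a) = exchanged (point-non-interior a)
          where
          exchanged : NonInterior vertex (point a) → NonInterior vertex′ (point a)
          exchanged (c , Σc≡1 , p≡c , c-nonpositive) =
            new c , trans (sum-new sum-g c) Σc≡1 , (λ j → trans (p≡c j) (sym (comb-new vertex q q≡comb c j))) ,
            new-nonpositive g-nonneg (1/g-nonneg i) c c-nonpositive

      split-back : Split vertex′ (new weight) → Split vertex weight
      split-back σ = record
        { part          = old part
        ; part-nonneg   = old-nonneg g-nonneg part part-nonneg
        ; part≤         = λ l → 0≤q-p⇒p≤q (subst (0ℚ ≤_) (gap l)
                            (old-nonneg g-nonneg (λ l → new weight l - part l) (λ l → p≤q⇒0≤q-p (part≤ l)) l))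
        ; sum-part      = trans (sum-old sum-g part) sum-part
        ; part-integral = proj₁ part-integral , λ j → trans (proj₂ part-integral j) (comb-exchange vertex q q≡comb part j)
        ; part-not-half = λ half → part-not-half (old-injective (λ l → part l + part l) (new weight)
                            (λ l → trans (old-+ part part l) (trans (half l) (sym (old-new weight l)))))
        }
        where
        open Split σ
        gap : ∀ l → old (λ l → new weight l - part l) l ≡ weight l - old part l
        gap l = trans (old-minus (new weight) part l) (cong (_- old part l) (old-new weight l))

      proportional-if-vertex′ : IsVertex (new weight) → ∀ l → weight l ≡ (κ + κ) * g l
      proportional-if-vertex′ (j , new≡2κδ) = cases-at {P = VertexAt} i at-i elsewhere j new≡2κδ
        where
        VertexAt : Fin n → Set
        VertexAt j = (∀ l → new weight l ≡ (κ + κ) * δ j l) → ∀ l → weight l ≡ (κ + κ) * g l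
        at-i : VertexAt i
        at-i new≡2κδᵢ l = trans (sym (old-new weight l)) (trans (old-cong new≡2κδᵢ l) (old-δ (κ + κ) l))
        elsewhere : ∀ j → i ≢ j → VertexAt j
        elsewhere j i≢j new≡2κδⱼ = ⊥-elim (ℚP.<-irrefl refl (subst (0ℚ <_) wᵢ≡0 (weight-pos i)))
          where
          wᵢ≡0 : weight i ≡ 0ℚ
          wᵢ≡0 = begin
            weight i                   ≡⟨ old-new weight i ⟨
            old (new weight) i         ≡⟨ old-i (new weight) ⟩
            new weight i * g i         ≡⟨ cong (_* g i) (trans (new≡2κδⱼ i) (trans (cong ((κ + κ) *_) (δ-≢ (i≢j ∘ sym)))
                                            (ℚP.*-zeroʳ (κ + κ)))) ⟩
            0ℚ * g i                   ≡⟨ ℚP.*-zeroˡ (g i) ⟩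
            0ℚ                         ∎
            where open ≡-Reasoning

    split-by-exchange : SplitsAt (suc t) → Split vertex weight
    split-by-exchange splits = pivot-at (argmin (λ l → weight l * ℚ.1/ g l))
      where
      pivot-at : (Σ (Fin n) λ i → ∀ l → weight i * ℚ.1/ g i ≤ weight l * ℚ.1/ g l) → Split vertex weight
      pivot-at (i , i-minimal) = by-cases (isVertex? new-weight)
        where
        open Pivot i i-minimal
        new-weight : Fin n → ℚ
        new-weight = Exchange.new g i weight
        by-cases : Dec (IsVertex new-weight) → Split vertex weight
        by-cases (yes vertex′-weights) =
          Proportional.split (proj₁ positive-floor) (proj₂ positive-floor) (proportional-if-vertex′ vertex′-weights)
        by-cases (no ¬vertex′-weights) = split-back (splits simplex′ trail′ weights′ ¬vertex′-weights)

  IsFloor : ∀ {V y} → Weights V y → (Fin n → ℕ) → Set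
  IsFloor w m = (∀ l → toℚ (ℤ.+ m l) ≤ Weights.weight w l) × (∀ l → Weights.weight w l < toℚ (ℤ.+ m l) + 1ℚ)

  floor-weights : ∀ {V y} (w : Weights V y) → Σ (Fin n → ℕ) (IsFloor w)
  floor-weights w = (λ l → proj₁ (⌊w⌋ l)) , (λ l → proj₁ (proj₂ (⌊w⌋ l))) , (λ l → proj₂ (proj₂ (⌊w⌋ l)))
    where
    open Weights w
    ⌊w⌋ : ∀ l → Σ ℕ λ m → toℚ (ℤ.+ m) ≤ weight l × weight l < toℚ (ℤ.+ m) + 1ℚ
    ⌊w⌋ l = floorℕ (weight l) (weight-nonneg l)

  splits : ∀ fuel t → suc d ℕ.^ n ℕ.< t ℕ.+ fuel → SplitsAt t
  splits zero t bound S T w ¬vertex = ⊥-elim (ℕP.<⇒≱ (subst (suc d ℕ.^ n ℕ.<_) (ℕP.+-identityʳ t) bound)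
    (box-pigeonhole d (Trail.point T) (Trail.point-in-box T) (Trail.distinct T)))
  splits (suc fuel) t bound S T w ¬vertex = by-floors (floor-weights w)
    where
    by-floors : Σ (Fin n → ℕ) (IsFloor w) → Split (BoxSimplex.vertex S) (Weights.weight w)
    by-floors (m , m≤w , w<m+1) = by-size (k ℕ.≤? ℕΣ.sum m)
      where
      by-size : Dec (k ℕ.≤ ℕΣ.sum m) → Split (BoxSimplex.vertex S) (Weights.weight w)
      by-size (yes k≤M) = Floors.Excess.split w m m≤w w<m+1 k≤M ¬vertex
      by-size (no  k≰M) = Exchanging.split-by-exchange S T w m m≤w w<m+1
        (ℕP.≤-antisym (ℕP.≰⇒> k≰M) (Floors.floor-sum-large w m m≤w w<m+1))
        (splits fuel (suc t) (subst (suc d ℕ.^ n ℕ.<_) (ℕP.+-suc t fuel) bound))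

  split : (S : BoxSimplex) → ∀ {y} (w : Weights (BoxSimplex.vertex S) y) → ¬ IsVertex (Weights.weight w) →
    Split (BoxSimplex.vertex S) (Weights.weight w)
  split S = splits (suc (suc d ℕ.^ n)) 0 (ℕP.n<1+n _) S empty
    where
    empty : Trail (BoxSimplex.vertex S) 0
    empty = record { point = λ () ; distinct = λ () ; point-in-box = λ () ; point-non-interior = λ () }

  module Mediating (u : Fin n → Point n) (u-even : ∀ i → AllEven (u i)) (u≥0 : ∀ i j → ℤ.+ 0 ℤ.≤ u i j)
    (Σu≡2d : ∀ i → sumℤ n (u i) ≡ ℤ.+ (2 ℕ.* d)) (u-independent : AffinelyIndependent u) where

    v : Fin n → Point n
    v = scaleVerts k u

    V : Fin n → Point n
    V l j = ℤ.+ ℕD._∣_.quotient (u-even l j)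

    u≡V+V : ∀ l j → u l j ≡ V l j ℤ.+ V l j
    u≡V+V l j = begin
      u l j                      ≡⟨ ℤP.0≤i⇒+∣i∣≡i (u≥0 l j) ⟨
      ℤ.+ ℤ.∣ u l j ∣            ≡⟨ cong ℤ.+_ (ℕD._∣_.equality (u-even l j)) ⟩
      ℤ.+ (h ℕ.* 2)              ≡⟨ cong ℤ.+_ (trans (ℕP.*-comm h 2) (cong (h ℕ.+_) (ℕP.+-identityʳ h))) ⟩
      ℤ.+ (h ℕ.+ h)              ≡⟨ ℤP.pos-+ h h ⟩
      V l j ℤ.+ V l j            ∎
      where
      open ≡-Reasoning
      h : ℕ
      h = ℕD._∣_.quotient (u-even l j)

    toℚ-u : ∀ l j → toℚ (u l j) ≡ toℚ (V l j) + toℚ (V l j)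
    toℚ-u l j = trans (cong toℚ (u≡V+V l j)) (toℚ-homo-+ (V l j) (V l j))

    toℚ-v : ∀ l j → toℚ (v l j) ≡ (κ + κ) * toℚ (V l j)
    toℚ-v l j = trans (toℚ-homo-* (ℤ.+ k) (u l j)) (trans (cong (κ *_) (toℚ-u l j))
      (solve 2 (λ K x → K :* (x :+ x) := (K :+ K) :* x) refl κ (toℚ (V l j))))

    comb-v : ∀ β j → comb v β j ≡ comb V (λ l → (κ + κ) * β l) j
    comb-v β j = sumℚ-cong n (λ l → trans (cong (β l *_) (toℚ-v l j))
      (solve 3 (λ b K x → b :* (K :* x) := (K :* b) :* x) refl (β l) (κ + κ) (toℚ (V l j))))

    simplex : BoxSimplex
    simplex = record { vertex = V ; independent = V-independent ; vertex-in-box = V-in-box }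
      where
      V-independent : AffinelyIndependent V
      V-independent μ Σμ≡0 combμ≡0 = u-independent μ Σμ≡0 λ j → begin
        comb u μ j                                    ≡⟨ sumℚ-cong n (λ l → trans (cong (μ l *_) (toℚ-u l j)) (ℚP.*-distribˡ-+ (μ l) (toℚ (V l j)) (toℚ (V l j)))) ⟩
        sumℚ n (λ l → μ l * toℚ (V l j) + μ l * toℚ (V l j)) ≡⟨ sumℚ-+ n (λ l → μ l * toℚ (V l j)) (λ l → μ l * toℚ (V l j)) ⟩
        comb V μ j + comb V μ j                       ≡⟨ cong₂ _+_ (combμ≡0 j) (combμ≡0 j) ⟩
        0ℚ                                            ∎
        where open ≡-Reasoning
      V-in-box : ∀ l → InBox d (V l)
      V-in-box l j = ℤ.+≤+ z≤n , toℚ-cancel-≤ (0≤q-p⇒p≤q (0≤p+p⇒0≤p (subst (0ℚ ≤_) double-gap (p≤q⇒0≤q-p 2X≤2D))))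
        where
        X D : ℚ
        X = toℚ (V l j)
        D = toℚ (ℤ.+ d)
        2X≤2D : X + X ≤ D + D
        2X≤2D = begin
          X + X                              ≡⟨ toℚ-u l j ⟨
          toℚ (u l j)                        ≤⟨ term≤sumℚ n (λ j → toℚ-mono-≤ (u≥0 l j)) j ⟩
          sumℚ n (toℚ ∘ u l)                 ≡⟨ toℚ-sumℤ n (u l) ⟨
          toℚ (sumℤ n (u l))                 ≡⟨ cong toℚ (Σu≡2d l) ⟩
          toℚ (ℤ.+ (d ℕ.+ (d ℕ.+ 0)))        ≡⟨ cong (λ e → toℚ (ℤ.+ (d ℕ.+ e))) (ℕP.+-identityʳ d) ⟩
          toℚ (ℤ.+ (d ℕ.+ d))                ≡⟨ toℚ-homo-+ (ℤ.+ d) (ℤ.+ d) ⟩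
          D + D                              ∎
          where open ℚP.≤-Reasoning
        double-gap : (D + D) - (X + X) ≡ (D - X) + (D - X)
        double-gap = solve 2 (λ D x → (D :+ D) :- (x :+ x) := (D :- x) :+ (D :- x)) refl D X

    weights-of-conv : ∀ {y} → InConv v y → Weights V y
    weights-of-conv (λ' , λ'≥0 , Σλ'≡1 , y≡) = record
      { weight        = λ l → (κ + κ) * λ' l
      ; weight-nonneg = λ l → nonNeg*nonNeg (ℚP.+-mono-≤ (0≤toℚ+ k) (0≤toℚ+ k)) (λ'≥0 l)
      ; sum-weight    = trans (sumℚ-*ˡ n (κ + κ) λ') (trans (cong ((κ + κ) *_) Σλ'≡1) (ℚP.*-identityʳ (κ + κ)))
      ; weight-comb   = λ j → trans (y≡ j) (comb-v λ' j)
      }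

    private
      κ-pos : 0ℚ < κ
      κ-pos = toℚ-mono-< (ℤ.+<+ (ℕP.≤-trans (s≤s z≤n) 2≤k))

      instance
        κ≢0 : ℚ.NonZero κ
        κ≢0 = ℚP.pos⇒nonZero κ {{ℚ.positive κ-pos}}

    in-conv-of-double : ∀ c → (∀ l → 0ℚ ≤ c l) → sumℚ n c ≡ κ → ∀ z → (∀ j → toℚ (z j) ≡ comb V c j + comb V c j) → InConv v z
    in-conv-of-double c c≥0 Σc≡κ z z≡ =
      (λ l → c l * ℚ.1/ κ) ,
      (λ l → nonNeg*nonNeg (c≥0 l) (ℚP.<⇒≤ (ℚP.positive⁻¹ (ℚ.1/ κ) {{ℚP.1/pos⇒pos κ {{ℚ.positive κ-pos}}}}))) ,
      trans (sumℚ-cong n (λ l → ℚP.*-comm (c l) (ℚ.1/ κ))) (trans (sumℚ-*ˡ n (ℚ.1/ κ) c) (trans (cong (ℚ.1/ κ *_) Σc≡κ) (ℚP.*-inverseˡ κ))) ,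
      λ j → begin
        toℚ (z j)                                            ≡⟨ z≡ j ⟩
        comb V c j + comb V c j                              ≡⟨ sumℚ-+ n (λ l → c l * toℚ (V l j)) (λ l → c l * toℚ (V l j)) ⟨
        sumℚ n (λ l → c l * toℚ (V l j) + c l * toℚ (V l j)) ≡⟨ sumℚ-cong n (λ l → rescale (c l) (toℚ (V l j))) ⟩
        comb V (λ l → (κ + κ) * (c l * ℚ.1/ κ)) j            ≡⟨ comb-v (λ l → c l * ℚ.1/ κ) j ⟨
        comb v (λ l → c l * ℚ.1/ κ) j                        ∎
      where
      open ≡-Reasoning
      rescale : ∀ a x → a * x + a * x ≡ ((κ + κ) * (a * ℚ.1/ κ)) * x
      rescale a x = begin
        a * x + a * x                        ≡⟨ solve 2 (λ a x → a :* x :+ a :* x := (a :* x :+ a :* x) :* con 1ℚ) refl a x ⟩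
        (a * x + a * x) * 1ℚ                 ≡⟨ cong ((a * x + a * x) *_) (ℚP.*-inverseʳ κ) ⟨
        (a * x + a * x) * (κ * ℚ.1/ κ)       ≡⟨ solve 4 (λ a x K i → (a :* x :+ a :* x) :* (K :* i) := ((K :+ K) :* (a :* i)) :* x) refl a x κ (ℚ.1/ κ) ⟩
        ((κ + κ) * (a * ℚ.1/ κ)) * x         ∎

    IsMidpoint : Point n → Set
    IsMidpoint y = Σ (Point n) λ z₁ → Σ (Point n) λ z₂ →
      ¬ (z₁ ≈ₚ z₂) × InConv v z₁ × InConv v z₂ × AllEven z₁ × AllEven z₂ × (∀ j → ℤ.+ 2 ℤ.* y j ≡ z₁ j ℤ.+ z₂ j)

    vertex-of-weights : ∀ {y} (w : Weights V y) → IsVertex (Weights.weight w) → ∃ λ i → y ≈ₚ v i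
    vertex-of-weights {y} w (i , w≡2κδ) = i , λ j → toℚ-injective (begin
      toℚ (y j)                                      ≡⟨ weight-comb j ⟩
      comb V weight j                                ≡⟨ sumℚ-cong n (λ l → trans (cong (_* toℚ (V l j)) (w≡2κδ l)) (ℚP.*-assoc (κ + κ) (δ i l) (toℚ (V l j)))) ⟩
      sumℚ n (λ l → (κ + κ) * (δ i l * toℚ (V l j))) ≡⟨ sumℚ-*ˡ n (κ + κ) (λ l → δ i l * toℚ (V l j)) ⟩
      (κ + κ) * sumℚ n (λ l → δ i l * toℚ (V l j))   ≡⟨ cong ((κ + κ) *_) (sumℚ-δ* n i (λ l → toℚ (V l j))) ⟩
      (κ + κ) * toℚ (V i j)                          ≡⟨ toℚ-v i j ⟨
      toℚ (v i j)                                    ∎)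
      where
      open Weights w
      open ≡-Reasoning

    midpoint-of-split : ∀ {y} (w : Weights V y) → Split V (Weights.weight w) → IsMidpoint y
    midpoint-of-split {y} w σ = z₁ , z₂ , z₁≉z₂ ,
      in-conv-of-double part part-nonneg sum-part z₁ z₁≡ ,
      in-conv-of-double rest (λ l → p≤q⇒0≤q-p (part≤ l)) sum-rest z₂ z₂≡ ,
      (λ j → even-2* (a j)) , (λ j → even-2* (y j ℤ.- a j)) , y≡midpoint
      where
      open Weights w
      open Split σ
      a : Point n
      a = proj₁ part-integral
      z₁ z₂ : Point n
      z₁ j = ℤ.+ 2 ℤ.* a j
      z₂ j = ℤ.+ 2 ℤ.* (y j ℤ.- a j)
      rest : Fin n → ℚ
      rest l = weight l - part l
      sum-rest : sumℚ n rest ≡ κ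
      sum-rest = trans (sumℚ-minus n weight part) (trans (cong₂ _-_ sum-weight sum-part) (solve 1 (λ K → (K :+ K) :- K := K) refl κ))
      z₁≡ : ∀ j → toℚ (z₁ j) ≡ comb V part j + comb V part j
      z₁≡ j = trans (toℚ-double (a j)) (cong₂ _+_ (proj₂ part-integral j) (proj₂ part-integral j))
      y-a≡ : ∀ j → toℚ (y j ℤ.- a j) ≡ comb V rest j
      y-a≡ j = trans (toℚ-homo-minus (y j) (a j)) (trans (cong₂ _-_ (weight-comb j) (proj₂ part-integral j)) (sym (comb-minus V weight part j)))
      z₂≡ : ∀ j → toℚ (z₂ j) ≡ comb V rest j + comb V rest j
      z₂≡ j = trans (toℚ-double (y j ℤ.- a j)) (cong₂ _+_ (y-a≡ j) (y-a≡ j))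
      z₁≉z₂ : ¬ (z₁ ≈ₚ z₂)
      z₁≉z₂ z₁≈z₂ = part-not-half λ l → trans (cong (part l +_) (part≡rest l)) (solve 2 (λ p w → p :+ (w :- p) := w) refl (part l) (weight l))
        where
        part≡rest : ∀ l → part l ≡ rest l
        part≡rest = barycentric-unique {V = V} (BoxSimplex.independent simplex) part rest (trans sum-part (sym sum-rest))
          (λ j → p+p≡q+q⇒p≡q (trans (sym (z₁≡ j)) (trans (cong toℚ (z₁≈z₂ j)) (z₂≡ j))))
      y≡midpoint : ∀ j → ℤ.+ 2 ℤ.* y j ≡ z₁ j ℤ.+ z₂ j
      y≡midpoint j = begin
        ℤ.+ 2 ℤ.* y j                         ≡⟨ cong (ℤ.+ 2 ℤ.*_) (trans (sym (xyx⁻¹≈y (a j) (y j))) (ℤP.+-assoc (a j) (y j) (ℤ.- a j))) ⟩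
        ℤ.+ 2 ℤ.* (a j ℤ.+ (y j ℤ.- a j))     ≡⟨ ℤP.*-distribˡ-+ (ℤ.+ 2) (a j) (y j ℤ.- a j) ⟩
        z₁ j ℤ.+ z₂ j                         ∎
        where open ≡-Reasoning

    vertex-or-midpoint : ∀ y → InConv v y → (∃ λ i → y ≈ₚ v i) ⊎ IsMidpoint y
    vertex-or-midpoint y y∈ = by-cases (isVertex? weight)
      where
      w : Weights V y
      w = weights-of-conv y∈
      open Weights w
      by-cases : Dec (IsVertex weight) → (∃ λ i → y ≈ₚ v i) ⊎ IsMidpoint y
      by-cases (yes vertex) = inj₁ (vertex-of-weights w vertex)
      by-cases (no ¬vertex) = inj₂ (midpoint-of-split w (split simplex w ¬vertex))

open import Data.Nat using (_≤_; _∸_; _*_)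

theorem3p6 : (n d : ℕ) → 4 ≤ n → 1 ≤ d →
    (u : Fin n → Point n) →
    (∀ i → AllEven (u i)) →
    (∀ i j → ℤ.+ 0 ℤ.≤ u i j) →
    (∀ i → sumℤ n (u i) ≡ ℤ.+ (2 * d)) →
    AffinelyIndependent u →
    Mediated (scaleVerts (n ∸ 2) u) (InConv (scaleVerts (n ∸ 2) u))
theorem3p6 zero          d ()
theorem3p6 (suc zero)    d (s≤s ())
theorem3p6 (suc (suc k)) d (s≤s (s≤s 2≤k)) _ u u-even u≥0 Σu≡2d independent =
  even-scaleVerts k u u-even , (λ _ y∈ → y∈) , Rationals.vertex-in-conv v , vertex-or-midpoint
  where open Splitting.Mediating k d 2≤k u u-even u≥0 Σu≡2d independent
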